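{- Let $X$ be a 2-signature. For every tuple of reductions $\Gamma\vdash Q\colon N\to N'\colon\Delta$ and every reduction $\Delta\vdash P\colon M\to M'\colon A$, we have the permutation equivalence $$\Gamma\vdash P[Q]\equiv \big(M[Q];_{M[N']}P[N']\big)\colon M[N]\to M'[N']\colon A,$$ where $P[Q]=P[N];_{M'[N]}M'[Q]$.
   Context: Types over a set $X_0$: $A,B::=x\mid1\mid A\times B\mid B^A$. A 2-signature $X$ consists of sorts $X_0$, operations $X_1$ each over a sequent $(G_1,\ldots,G_n\vdash A)$, and rules $X_2$ with a map $a$ sending each rule to a pair $(G\vdash M,N\colon A)$ of terms of the same type of the simply-typed $\lambda$-calculus with unit, products, functions, base types $X_0$ and term formers $c\langle M_1,\ldots,M_n\rangle$ ($c\in X_1$), modulo $\beta\eta$; write $r\in X(G\vdash M,N\colon A)$. Reductions $\Gamma\vdash P\colon M\to N\colon A$ are generated by rule application $r\langle P_1,\ldots,P_n\rangle\colon M[M_1,\ldots,M_n]\to N[N_1,\ldots,N_n]\colon A$ (for $r\in X(G\vdash M,N\colon A)$, $\Gamma\vdash P_i\colon M_i\to N_i\colon G_i$), vertical composition $P;_{M_2}Q\colon M_1\to M_3$ (for $P\colon M_1\to M_2$, $Q\colon M_2\to M_3$), and the term constructors lifted to reductions: $x\colon x\to x$, $()\colon()\to()$, $c\langle P_1,\ldots,P_n\rangle$, $\lambda x{:}A.P$, $PQ\colon MN\to M'N'$, $(P,Q)$, $\pi P$, $\pi'P$; weakening is implicit, and every term $M$ is read as a reduction $M\colon M\to M$.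 A tuple $\Gamma\vdash Q\colon N\to N'\colon\Delta$ means reductions $\Gamma\vdash Q_i\colon N_i\to N'_i\colon\Delta_i$ for each variable $x_i$ of $\Delta$. Left whiskering $M[Q]$ replaces each $x_i$ by $Q_i$ in the term $M$, structurally through all term constructors (with $(\lambda x.M)[Q]=\lambda x.M[Q,x]$). Right whiskering $P[N]$ substitutes the terms $N_i$ for $x_i$ in the reduction $P$, structurally through all constructors, with $r\langle P_1,\ldots\rangle[N]=r\langle P_1[N],\ldots\rangle$ and $(P_1;_{M''}P_2)[N]=P_1[N];_{M''[N]}P_2[N]$. Permutation equivalence $\equiv$ is the least congruence (equivalence relation compatible with all reduction constructors) on reductions of equal type containing: associativity of $;$ and $M;P\equiv P\equiv P;N$ for $P\colon M\to N$; $(\lambda x.P)Q\equiv P[Q/x]$, $P\equiv\lambda x.(Px)$ ($x$ fresh), $\pi(P,Q)\equiv P$, $\pi'(P,Q)\equiv Q$, $P\equiv(\pi P,\pi'P)$, $P\equiv()$ at type $1$; for $r\in X(\Gamma\vdash M_1,M_2\colon A)$ and tuples $P\colon N_1\to N_2$, $Q\colon N_2\to N_3$: $r\langle P;Q\rangle\equiv M_1[P];r\langle Q\rangle$ and $r\langle P;Q\rangle\equiv r\langle P\rangle;M_2[Q]$; and each of $c\langle-\rangle$, $\lambda x$, application, pairing, $\pi$, $\pi'$ commutes with $;$ componentwise (e.g. $c\langle P;Q\rangle\equiv c\langle P\rangle;c\langle Q\rangle$, $(P;P')(Q;Q')\equiv(PQ);(P'Q')$). -}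

module Defs where

open import Data.List using (List; []; _∷_)

-- Simple types over a set of sorts X₀:  A, B ::= x | 1 | A × B | B^A
-- (B^A is written  A ⇒ B).

infixr 7 _⇒_
infixr 8 _⊗_

data Ty (S : Set) : Set where
  `_  : S → Ty S
  𝟙   : Ty S
  _⊗_ : Ty S → Ty S → Ty S
  _⇒_ : Ty S → Ty S → Ty S

Ctx : Set → Set
Ctx S = List (Ty S)

data _∋_ {S : Set} : Ctx S → Ty S → Set where
  here  : ∀ {Γ A} → (A ∷ Γ) ∋ A
  there : ∀ {Γ A B} → Γ ∋ A → (B ∷ Γ) ∋ A

record Sig1 : Set₁ where
  field
    Sort : Set
    Op   : Set
    dom  : Op → List (Ty Sort)
    cod  : Op → Ty Sort

module Terms (Σ₁ : Sig1) where
  open Sig1 Σ₁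

  T : Set
  T = Ty Sort
  C : Set
  C = Ctx Sort

  variable
    A B : T
    Γ Δ Θ : C

  mutual
    data Tm (Γ : C) : T → Set where
      var  : Γ ∋ A → Tm Γ A
      tt   : Tm Γ 𝟙
      op   : (c : Op) → Tms Γ (dom c) → Tm Γ (cod c)
      lam  : Tm (A ∷ Γ) B → Tm Γ (A ⇒ B)
      app  : Tm Γ (A ⇒ B) → Tm Γ A → Tm Γ B
      pair : Tm Γ A → Tm Γ B → Tm Γ (A ⊗ B)
      fst  : Tm Γ (A ⊗ B) → Tm Γ A
      snd  : Tm Γ (A ⊗ B) → Tm Γ B

    -- Tms Γ Δ : a tuple of terms in context Γ, one for each variable of Δ
    -- (i.e. a substitution Γ → Δ).
    data Tms (Γ : C) : C → Set where
      []  : Tms Γ []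
      _∷_ : Tm Γ A → Tms Γ Δ → Tms Γ (A ∷ Δ)

  Ren : C → C → Set
  Ren Γ Δ = ∀ {A} → Γ ∋ A → Δ ∋ A

  ext : Ren Γ Δ → Ren (A ∷ Γ) (A ∷ Δ)
  ext ρ here      = here
  ext ρ (there x) = there (ρ x)

  mutual
    ren : Ren Γ Δ → Tm Γ A → Tm Δ A
    ren ρ (var x)    = var (ρ x)
    ren ρ tt         = tt
    ren ρ (op c Ms)  = op c (rens ρ Ms)
    ren ρ (lam M)    = lam (ren (ext ρ) M)
    ren ρ (app M N)  = app (ren ρ M) (ren ρ N)
    ren ρ (pair M N) = pair (ren ρ M) (ren ρ N)
    ren ρ (fst M)    = fst (ren ρ M)
    ren ρ (snd M)    = snd (ren ρ M)

    rens : Ren Γ Δ → Tms Γ Θ → Tms Δ Θ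
    rens ρ []       = []
    rens ρ (M ∷ Ms) = ren ρ M ∷ rens ρ Ms

  wk : Tm Γ B → Tm (A ∷ Γ) B
  wk = ren there

  lookup : Tms Γ Δ → Δ ∋ A → Tm Γ A
  lookup (M ∷ Ms) here      = M
  lookup (M ∷ Ms) (there x) = lookup Ms x

  lift : Tms Γ Δ → Tms (A ∷ Γ) (A ∷ Δ)
  lift σ = var here ∷ rens there σ

  idS : Tms Γ Γ
  idS {[]}    = []
  idS {A ∷ Γ} = lift idS

  mutual
    sub : Tm Δ A → Tms Γ Δ → Tm Γ A
    sub (var x)    σ = lookup σ x
    sub tt         σ = tt
    sub (op c Ms)  σ = op c (subs Ms σ)
    sub (lam M)    σ = lam (sub M (lift σ))
    sub (app M N)  σ = app (sub M σ) (sub N σ)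
    sub (pair M N) σ = pair (sub M σ) (sub N σ)
    sub (fst M)    σ = fst (sub M σ)
    sub (snd M)    σ = snd (sub M σ)

    subs : Tms Δ Θ → Tms Γ Δ → Tms Γ Θ
    subs []       σ = []
    subs (M ∷ Ms) σ = sub M σ ∷ subs Ms σ

  -- βη-conversion (terms are taken modulo this relation)
  infix 4 _≈_ _≈s_
  mutual
    data _≈_ {Γ : C} : {A : T} → Tm Γ A → Tm Γ A → Set where
      ≈refl  : {M : Tm Γ A} → M ≈ M
      ≈sym   : {M N : Tm Γ A} → M ≈ N → N ≈ M
      ≈trans : {M N K : Tm Γ A} → M ≈ N → N ≈ K → M ≈ K
      β      : {M : Tm (A ∷ Γ) B} {N : Tm Γ A} → app (lam M) N ≈ sub M (N ∷ idS)
      η      : {M : Tm Γ (A ⇒ B)} → M ≈ lam (app (wk M) (var here))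
      β₁     : {M : Tm Γ A} {N : Tm Γ B} → fst (pair M N) ≈ M
      β₂     : {M : Tm Γ A} {N : Tm Γ B} → snd (pair M N) ≈ N
      η⊗     : {M : Tm Γ (A ⊗ B)} → M ≈ pair (fst M) (snd M)
      η𝟙     : {M : Tm Γ 𝟙} → M ≈ tt
      c-op   : {c : Op} {Ms Ns : Tms Γ (dom c)} → Ms ≈s Ns → op c Ms ≈ op c Ns
      c-lam  : {M N : Tm (A ∷ Γ) B} → M ≈ N → lam M ≈ lam N
      c-app  : {M M' : Tm Γ (A ⇒ B)} {N N' : Tm Γ A} → M ≈ M' → N ≈ N' → app M N ≈ app M' N'
      c-pair : {M M' : Tm Γ A} {N N' : Tm Γ B} → M ≈ M' → N ≈ N' → pair M N ≈ pair M' N'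
      c-fst  : {M N : Tm Γ (A ⊗ B)} → M ≈ N → fst M ≈ fst N
      c-snd  : {M N : Tm Γ (A ⊗ B)} → M ≈ N → snd M ≈ snd N

    data _≈s_ {Γ : C} : {Δ : C} → Tms Γ Δ → Tms Γ Δ → Set where
      []  : [] ≈s []
      _∷_ : {M N : Tm Γ A} {Ms Ns : Tms Γ Δ} → M ≈ N → Ms ≈s Ns → (M ∷ Ms) ≈s (N ∷ Ns)

-- Each rule carries its context G, its type A and its two terms M
-- (source, rlhs) and N (target, rrhs) (representatives modulo βη).

record Sig2 : Set₁ where
  field
    sig1 : Sig1
    Rule : Set
    rctx : Rule → Ctx (Sig1.Sort sig1)
    rty  : Rule → Ty (Sig1.Sort sig1)
    rlhs : (r : Rule) → Terms.Tm sig1 (rctx r) (rty r)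
    rrhs : (r : Rule) → Terms.Tm sig1 (rctx r) (rty r)

module Red (X : Sig2) where
  open Sig2 X
  open Sig1 sig1
  open Terms sig1 public

  infixl 5 _⨾⟨_⟩_

  -- raw reduction syntax; source and target are computed below
  mutual
    data Rd (Γ : C) : T → Set where
      rvar   : Γ ∋ A → Rd Γ A
      rtt    : Rd Γ 𝟙
      rop    : (c : Op) → Rds Γ (dom c) → Rd Γ (cod c)
      rlam   : Rd (A ∷ Γ) B → Rd Γ (A ⇒ B)
      rapp   : Rd Γ (A ⇒ B) → Rd Γ A → Rd Γ B
      rpair  : Rd Γ A → Rd Γ B → Rd Γ (A ⊗ B)
      rfst   : Rd Γ (A ⊗ B) → Rd Γ A
      rsnd   : Rd Γ (A ⊗ B) → Rd Γ B
      rule   : (r : Rule) → Rds Γ (rctx r) → Rd Γ (rty r)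
      _⨾⟨_⟩_ : Rd Γ A → Tm Γ A → Rd Γ A → Rd Γ A

    data Rds (Γ : C) : C → Set where
      []  : Rds Γ []
      _∷_ : Rd Γ A → Rds Γ Δ → Rds Γ (A ∷ Δ)

  mutual
    src : Rd Γ A → Tm Γ A
    src (rvar x)       = var x
    src rtt            = tt
    src (rop c Ps)     = op c (srcs Ps)
    src (rlam P)       = lam (src P)
    src (rapp P Q)     = app (src P) (src Q)
    src (rpair P Q)    = pair (src P) (src Q)
    src (rfst P)       = fst (src P)
    src (rsnd P)       = snd (src P)
    src (rule r Ps)    = sub (rlhs r) (srcs Ps)
    src (P ⨾⟨ M ⟩ Q)   = src P

    srcs : Rds Γ Δ → Tms Γ Δ
    srcs []       = []
    srcs (P ∷ Ps) = src P ∷ srcs Ps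

  mutual
    tgt : Rd Γ A → Tm Γ A
    tgt (rvar x)       = var x
    tgt rtt            = tt
    tgt (rop c Ps)     = op c (tgts Ps)
    tgt (rlam P)       = lam (tgt P)
    tgt (rapp P Q)     = app (tgt P) (tgt Q)
    tgt (rpair P Q)    = pair (tgt P) (tgt Q)
    tgt (rfst P)       = fst (tgt P)
    tgt (rsnd P)       = snd (tgt P)
    tgt (rule r Ps)    = sub (rrhs r) (tgts Ps)
    tgt (P ⨾⟨ M ⟩ Q)   = tgt Q

    tgts : Rds Γ Δ → Tms Γ Δ
    tgts []       = []
    tgts (P ∷ Ps) = tgt P ∷ tgts Ps

  -- well-formedness: every vertical composite P ;_{M} Q has
  -- tgt P = M = src Q modulo βη.  A well-formed P is a reduction
  -- Γ ⊢ P : src P → tgt P : A.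
  mutual
    data Wf {Γ : C} : {A : T} → Rd Γ A → Set where
      rvar  : {x : Γ ∋ A} → Wf (rvar x)
      rtt   : Wf rtt
      rop   : {c : Op} {Ps : Rds Γ (dom c)} → Wfs Ps → Wf (rop c Ps)
      rlam  : {P : Rd (A ∷ Γ) B} → Wf P → Wf (rlam P)
      rapp  : {P : Rd Γ (A ⇒ B)} {Q : Rd Γ A} → Wf P → Wf Q → Wf (rapp P Q)
      rpair : {P : Rd Γ A} {Q : Rd Γ B} → Wf P → Wf Q → Wf (rpair P Q)
      rfst  : {P : Rd Γ (A ⊗ B)} → Wf P → Wf (rfst P)
      rsnd  : {P : Rd Γ (A ⊗ B)} → Wf P → Wf (rsnd P)
      rule  : {r : Rule} {Ps : Rds Γ (rctx r)} → Wfs Ps → Wf (rule r Ps)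
      comp  : {P Q : Rd Γ A} {M : Tm Γ A} → Wf P → Wf Q →
              tgt P ≈ M → M ≈ src Q → Wf (P ⨾⟨ M ⟩ Q)

    data Wfs {Γ : C} : {Δ : C} → Rds Γ Δ → Set where
      []  : Wfs []
      _∷_ : {P : Rd Γ A} {Ps : Rds Γ Δ} → Wf P → Wfs Ps → Wfs (P ∷ Ps)

  mutual
    ⌜_⌝ : Tm Γ A → Rd Γ A
    ⌜ var x ⌝    = rvar x
    ⌜ tt ⌝       = rtt
    ⌜ op c Ms ⌝  = rop c ⌜ Ms ⌝s
    ⌜ lam M ⌝    = rlam ⌜ M ⌝
    ⌜ app M N ⌝  = rapp ⌜ M ⌝ ⌜ N ⌝
    ⌜ pair M N ⌝ = rpair ⌜ M ⌝ ⌜ N ⌝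
    ⌜ fst M ⌝    = rfst ⌜ M ⌝
    ⌜ snd M ⌝    = rsnd ⌜ M ⌝

    ⌜_⌝s : Tms Γ Δ → Rds Γ Δ
    ⌜ [] ⌝s     = []
    ⌜ M ∷ Ms ⌝s = ⌜ M ⌝ ∷ ⌜ Ms ⌝s

  mutual
    rren : Ren Γ Δ → Rd Γ A → Rd Δ A
    rren ρ (rvar x)     = rvar (ρ x)
    rren ρ rtt          = rtt
    rren ρ (rop c Ps)   = rop c (rrens ρ Ps)
    rren ρ (rlam P)     = rlam (rren (ext ρ) P)
    rren ρ (rapp P Q)   = rapp (rren ρ P) (rren ρ Q)
    rren ρ (rpair P Q)  = rpair (rren ρ P) (rren ρ Q)
    rren ρ (rfst P)     = rfst (rren ρ P)
    rren ρ (rsnd P)     = rsnd (rren ρ P)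
    rren ρ (rule r Ps)  = rule r (rrens ρ Ps)
    rren ρ (P ⨾⟨ M ⟩ Q) = rren ρ P ⨾⟨ ren ρ M ⟩ rren ρ Q

    rrens : Ren Γ Δ → Rds Γ Θ → Rds Δ Θ
    rrens ρ []       = []
    rrens ρ (P ∷ Ps) = rren ρ P ∷ rrens ρ Ps

  mutual
    _[_]ʳ : Rd Δ A → Tms Γ Δ → Rd Γ A
    rvar x       [ σ ]ʳ = ⌜ lookup σ x ⌝
    rtt          [ σ ]ʳ = rtt
    rop c Ps     [ σ ]ʳ = rop c (Ps [ σ ]ʳs)
    rlam P       [ σ ]ʳ = rlam (P [ lift σ ]ʳ)
    rapp P Q     [ σ ]ʳ = rapp (P [ σ ]ʳ) (Q [ σ ]ʳ)
    rpair P Q    [ σ ]ʳ = rpair (P [ σ ]ʳ) (Q [ σ ]ʳ)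
    rfst P       [ σ ]ʳ = rfst (P [ σ ]ʳ)
    rsnd P       [ σ ]ʳ = rsnd (P [ σ ]ʳ)
    rule r Ps    [ σ ]ʳ = rule r (Ps [ σ ]ʳs)
    (P ⨾⟨ M ⟩ Q) [ σ ]ʳ = (P [ σ ]ʳ) ⨾⟨ sub M σ ⟩ (Q [ σ ]ʳ)

    _[_]ʳs : Rds Δ Θ → Tms Γ Δ → Rds Γ Θ
    []       [ σ ]ʳs = []
    (P ∷ Ps) [ σ ]ʳs = (P [ σ ]ʳ) ∷ (Ps [ σ ]ʳs)

  rlookup : Rds Γ Δ → Δ ∋ A → Rd Γ A
  rlookup (P ∷ Ps) here      = P
  rlookup (P ∷ Ps) (there x) = rlookup Ps x

  rlift : Rds Γ Δ → Rds (A ∷ Γ) (A ∷ Δ)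
  rlift Q = rvar here ∷ rrens there Q

  mutual
    _⟦_⟧ : Tm Δ A → Rds Γ Δ → Rd Γ A
    var x    ⟦ Q ⟧ = rlookup Q x
    tt       ⟦ Q ⟧ = rtt
    op c Ms  ⟦ Q ⟧ = rop c (Ms ⟦ Q ⟧s)
    lam M    ⟦ Q ⟧ = rlam (M ⟦ rlift Q ⟧)
    app M N  ⟦ Q ⟧ = rapp (M ⟦ Q ⟧) (N ⟦ Q ⟧)
    pair M N ⟦ Q ⟧ = rpair (M ⟦ Q ⟧) (N ⟦ Q ⟧)
    fst M    ⟦ Q ⟧ = rfst (M ⟦ Q ⟧)
    snd M    ⟦ Q ⟧ = rsnd (M ⟦ Q ⟧)

    _⟦_⟧s : Tms Δ Θ → Rds Γ Δ → Rds Γ Θ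
    []       ⟦ Q ⟧s = []
    (M ∷ Ms) ⟦ Q ⟧s = (M ⟦ Q ⟧) ∷ (Ms ⟦ Q ⟧s)

  _[_]ʰ : Rd Δ A → Rds Γ Δ → Rd Γ A
  P [ Q ]ʰ = (P [ srcs Q ]ʳ) ⨾⟨ sub (tgt P) (srcs Q) ⟩ (tgt P ⟦ Q ⟧)

  vcomp : Rd Γ A → Tm Γ A → Rd Γ A → Rd Γ A
  vcomp P M Q = P ⨾⟨ M ⟩ Q

  compS : Rds Γ Δ → Tms Γ Δ → Rds Γ Δ → Rds Γ Δ
  compS []       []       []       = []
  compS (P ∷ Ps) (M ∷ Ms) (Q ∷ Qs) = (P ⨾⟨ M ⟩ Q) ∷ compS Ps Ms Qs

  -- permutation equivalence: least congruence on (well-formed)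
  -- reductions containing the listed generators.  Each generator is
  -- only imposed between well-formed reductions.
  infix 4 _≋_ _≋s_
  mutual
    data _≋_ {Γ : C} : {A : T} → Rd Γ A → Rd Γ A → Set where
      ≋refl  : {P : Rd Γ A} → Wf P → P ≋ P
      ≋sym   : {P Q : Rd Γ A} → P ≋ Q → Q ≋ P
      ≋trans : {P Q R : Rd Γ A} → P ≋ Q → Q ≋ R → P ≋ R
      c-op   : {c : Op} {Ps Qs : Rds Γ (dom c)} → Ps ≋s Qs → rop c Ps ≋ rop c Qs
      c-lam  : {P Q : Rd (A ∷ Γ) B} → P ≋ Q → rlam P ≋ rlam Q
      c-app  : {P P' : Rd Γ (A ⇒ B)} {Q Q' : Rd Γ A} → P ≋ P' → Q ≋ Q' → rapp P Q ≋ rapp P' Q'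
      c-pair : {P P' : Rd Γ A} {Q Q' : Rd Γ B} → P ≋ P' → Q ≋ Q' → rpair P Q ≋ rpair P' Q'
      c-fst  : {P Q : Rd Γ (A ⊗ B)} → P ≋ Q → rfst P ≋ rfst Q
      c-snd  : {P Q : Rd Γ (A ⊗ B)} → P ≋ Q → rsnd P ≋ rsnd Q
      c-rule : {r : Rule} {Ps Qs : Rds Γ (rctx r)} → Ps ≋s Qs → rule r Ps ≋ rule r Qs
      c-comp : {P P' Q Q' : Rd Γ A} {M M' : Tm Γ A} →
               P ≋ P' → M ≈ M' → Q ≋ Q' → (P ⨾⟨ M ⟩ Q) ≋ (P' ⨾⟨ M' ⟩ Q')
      assoc  : {P Q R : Rd Γ A} {M K : Tm Γ A} →
               let l = (P ⨾⟨ M ⟩ Q) ⨾⟨ K ⟩ R ; r = P ⨾⟨ M ⟩ (Q ⨾⟨ K ⟩ R) in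
               Wf l → Wf r → l ≋ r
      idˡ    : {P : Rd Γ A} {M K : Tm Γ A} →
               Wf (⌜ M ⌝ ⨾⟨ K ⟩ P) → Wf P → (⌜ M ⌝ ⨾⟨ K ⟩ P) ≋ P
      idʳ    : {P : Rd Γ A} {N K : Tm Γ A} →
               Wf (P ⨾⟨ K ⟩ ⌜ N ⌝) → Wf P → (P ⨾⟨ K ⟩ ⌜ N ⌝) ≋ P
      β      : {P : Rd (A ∷ Γ) B} {Q : Rd Γ A} →
               let l = rapp (rlam P) Q ; r = P [ Q ∷ ⌜ idS ⌝s ]ʰ in
               Wf l → Wf r → l ≋ r
      η      : {P : Rd Γ (A ⇒ B)} →
               let r = rlam (rapp (rren there P) (rvar here)) in
               Wf P → Wf r → P ≋ r
      β₁     : {P : Rd Γ A} {Q : Rd Γ B} →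
               Wf (rfst (rpair P Q)) → Wf P → rfst (rpair P Q) ≋ P
      β₂     : {P : Rd Γ A} {Q : Rd Γ B} →
               Wf (rsnd (rpair P Q)) → Wf Q → rsnd (rpair P Q) ≋ Q
      η⊗     : {P : Rd Γ (A ⊗ B)} →
               Wf P → Wf (rpair (rfst P) (rsnd P)) → P ≋ rpair (rfst P) (rsnd P)
      η𝟙     : {P : Rd Γ 𝟙} → Wf P → Wf {Γ} rtt → P ≋ rtt
      rule-l : {r : Rule} {P Q : Rds Γ (rctx r)} {N : Tms Γ (rctx r)} →
               let l = rule r (compS P N Q)
                   r' = (rlhs r ⟦ P ⟧) ⨾⟨ sub (rlhs r) N ⟩ rule r Q in
               Wf l → Wf r' → l ≋ r'
      rule-r : {r : Rule} {P Q : Rds Γ (rctx r)} {N : Tms Γ (rctx r)} →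
               let l = rule r (compS P N Q)
                   r' = rule r P ⨾⟨ sub (rrhs r) N ⟩ (rrhs r ⟦ Q ⟧) in
               Wf l → Wf r' → l ≋ r'
      op-⨾   : {c : Op} {P Q : Rds Γ (dom c)} {N : Tms Γ (dom c)} →
               let l = rop c (compS P N Q) ; r = rop c P ⨾⟨ op c N ⟩ rop c Q in
               Wf l → Wf r → l ≋ r
      lam-⨾  : {P Q : Rd (A ∷ Γ) B} {M : Tm (A ∷ Γ) B} →
               let l = rlam (P ⨾⟨ M ⟩ Q) ; r = rlam P ⨾⟨ lam M ⟩ rlam Q in
               Wf l → Wf r → l ≋ r
      app-⨾  : {P P' : Rd Γ (A ⇒ B)} {Q Q' : Rd Γ A} {M : Tm Γ (A ⇒ B)} {K : Tm Γ A} →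
               let l = rapp (P ⨾⟨ M ⟩ P') (Q ⨾⟨ K ⟩ Q')
                   r = rapp P Q ⨾⟨ app M K ⟩ rapp P' Q' in
               Wf l → Wf r → l ≋ r
      pair-⨾ : {P P' : Rd Γ A} {Q Q' : Rd Γ B} {M : Tm Γ A} {K : Tm Γ B} →
               let l = rpair (P ⨾⟨ M ⟩ P') (Q ⨾⟨ K ⟩ Q')
                   r = rpair P Q ⨾⟨ pair M K ⟩ rpair P' Q' in
               Wf l → Wf r → l ≋ r
      fst-⨾  : {P Q : Rd Γ (A ⊗ B)} {M : Tm Γ (A ⊗ B)} →
               let l = rfst (P ⨾⟨ M ⟩ Q) ; r = rfst P ⨾⟨ fst M ⟩ rfst Q in
               Wf l → Wf r → l ≋ r
      snd-⨾  : {P Q : Rd Γ (A ⊗ B)} {M : Tm Γ (A ⊗ B)} →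
               let l = rsnd (P ⨾⟨ M ⟩ Q) ; r = rsnd P ⨾⟨ snd M ⟩ rsnd Q in
               Wf l → Wf r → l ≋ r

    data _≋s_ {Γ : C} : {Δ : C} → Rds Γ Δ → Rds Γ Δ → Set where
      []  : [] ≋s []
      _∷_ : {P Q : Rd Γ A} {Ps Qs : Rds Γ Δ} → P ≋ Q → Ps ≋s Qs → (P ∷ Ps) ≋s (Q ∷ Qs)

-- By induction on the well-formedness of P. For a term former the two sides are related by
-- the functoriality of that former with respect to ;, for a rule application by the two
-- interchange generators of the rule, and for a composite P₁ ; P₂ by associativity and the two
-- induction hypotheses. The intermediate term of a composite is only βη-equal to tgt P₁ and to
-- src P₂, so one also needs that left whiskering M[Q] respects βη-conversion of M; its β case
-- rests on the functoriality of left whiskering, M[P ; R] ≡ M[P] ; M[R].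

module Submission where

open import Defs
open import Data.List using ([]; _∷_)
open import Relation.Binary.PropositionalEquality
open ≡-Reasoning

module TermProperties (Σ₁ : Sig1) where
  open Terms Σ₁

  variable Ψ : C

  lookup-rens : (ρ : Ren Γ Δ) (σ : Tms Γ Θ) (x : Θ ∋ A) → lookup (rens ρ σ) x ≡ ren ρ (lookup σ x)
  lookup-rens ρ (M ∷ σ) here      = refl
  lookup-rens ρ (M ∷ σ) (there x) = lookup-rens ρ σ x

  lookup-subs : (σ : Tms Δ Θ) (τ : Tms Γ Δ) (x : Θ ∋ A) → lookup (subs σ τ) x ≡ sub (lookup σ x) τ
  lookup-subs (M ∷ σ) τ here      = refl
  lookup-subs (M ∷ σ) τ (there x) = lookup-subs σ τ x

  lookup-idS : (x : Γ ∋ A) → lookup idS x ≡ var x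
  lookup-idS here      = refl
  lookup-idS (there x) = trans (lookup-rens there idS x) (cong (ren there) (lookup-idS x))

  ext-ext : {ρ₁ : Ren Δ Θ} {ρ₂ : Ren Γ Δ} {ρ₃ : Ren Γ Θ} →
    (∀ {A} (x : Γ ∋ A) → ρ₁ (ρ₂ x) ≡ ρ₃ x) →
    ∀ {A B} (x : (B ∷ Γ) ∋ A) → ext ρ₁ (ext ρ₂ x) ≡ ext ρ₃ x
  ext-ext h here      = refl
  ext-ext h (there x) = cong there (h x)

  ext-id : {ρ : Ren Γ Γ} → (∀ {A} (x : Γ ∋ A) → ρ x ≡ x) → ∀ {A B} (x : (B ∷ Γ) ∋ A) → ext ρ x ≡ x
  ext-id h here      = refl
  ext-id h (there x) = cong there (h x)

  lookup-lift-ext : {ρ : Ren Γ Δ} {σ : Tms Θ Δ} {τ : Tms Θ Γ} →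
    (∀ {A} (x : Γ ∋ A) → lookup σ (ρ x) ≡ lookup τ x) →
    ∀ {A B} (x : (B ∷ Γ) ∋ A) → lookup (lift σ) (ext ρ x) ≡ lookup (lift τ) x
  lookup-lift-ext h here = refl
  lookup-lift-ext {ρ = ρ} {σ} {τ} h (there x) = begin
    lookup (rens there σ) (ρ x)  ≡⟨ lookup-rens there σ (ρ x) ⟩
    ren there (lookup σ (ρ x))   ≡⟨ cong (ren there) (h x) ⟩
    ren there (lookup τ x)       ≡⟨ lookup-rens there τ x ⟨
    lookup (rens there τ) x      ∎

  mutual
    ren-ren : {ρ₁ : Ren Δ Θ} {ρ₂ : Ren Γ Δ} {ρ₃ : Ren Γ Θ} →
      (∀ {A} (x : Γ ∋ A) → ρ₁ (ρ₂ x) ≡ ρ₃ x) → (M : Tm Γ A) → ren ρ₁ (ren ρ₂ M) ≡ ren ρ₃ M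
    ren-ren h (var x)    = cong var (h x)
    ren-ren h tt         = refl
    ren-ren h (op c Ms)  = cong (op c) (rens-rens h Ms)
    ren-ren h (lam M)    = cong lam (ren-ren (ext-ext h) M)
    ren-ren h (app M N)  = cong₂ app (ren-ren h M) (ren-ren h N)
    ren-ren h (pair M N) = cong₂ pair (ren-ren h M) (ren-ren h N)
    ren-ren h (fst M)    = cong fst (ren-ren h M)
    ren-ren h (snd M)    = cong snd (ren-ren h M)

    rens-rens : {ρ₁ : Ren Δ Θ} {ρ₂ : Ren Γ Δ} {ρ₃ : Ren Γ Θ} →
      (∀ {A} (x : Γ ∋ A) → ρ₁ (ρ₂ x) ≡ ρ₃ x) → (Ms : Tms Γ Ψ) → rens ρ₁ (rens ρ₂ Ms) ≡ rens ρ₃ Ms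
    rens-rens h []       = refl
    rens-rens h (M ∷ Ms) = cong₂ _∷_ (ren-ren h M) (rens-rens h Ms)

  mutual
    ren-id : {ρ : Ren Γ Γ} → (∀ {A} (x : Γ ∋ A) → ρ x ≡ x) → (M : Tm Γ A) → ren ρ M ≡ M
    ren-id h (var x)    = cong var (h x)
    ren-id h tt         = refl
    ren-id h (op c Ms)  = cong (op c) (rens-id h Ms)
    ren-id h (lam M)    = cong lam (ren-id (ext-id h) M)
    ren-id h (app M N)  = cong₂ app (ren-id h M) (ren-id h N)
    ren-id h (pair M N) = cong₂ pair (ren-id h M) (ren-id h N)
    ren-id h (fst M)    = cong fst (ren-id h M)
    ren-id h (snd M)    = cong snd (ren-id h M)

    rens-id : {ρ : Ren Γ Γ} → (∀ {A} (x : Γ ∋ A) → ρ x ≡ x) → (Ms : Tms Γ Ψ) → rens ρ Ms ≡ Ms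
    rens-id h []       = refl
    rens-id h (M ∷ Ms) = cong₂ _∷_ (ren-id h M) (rens-id h Ms)

  mutual
    sub-ren : {ρ : Ren Γ Δ} {σ : Tms Θ Δ} {τ : Tms Θ Γ} →
      (∀ {A} (x : Γ ∋ A) → lookup σ (ρ x) ≡ lookup τ x) → (M : Tm Γ A) → sub (ren ρ M) σ ≡ sub M τ
    sub-ren h (var x)    = h x
    sub-ren h tt         = refl
    sub-ren h (op c Ms)  = cong (op c) (subs-rens h Ms)
    sub-ren h (lam M)    = cong lam (sub-ren (lookup-lift-ext h) M)
    sub-ren h (app M N)  = cong₂ app (sub-ren h M) (sub-ren h N)
    sub-ren h (pair M N) = cong₂ pair (sub-ren h M) (sub-ren h N)
    sub-ren h (fst M)    = cong fst (sub-ren h M)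
    sub-ren h (snd M)    = cong snd (sub-ren h M)

    subs-rens : {ρ : Ren Γ Δ} {σ : Tms Θ Δ} {τ : Tms Θ Γ} →
      (∀ {A} (x : Γ ∋ A) → lookup σ (ρ x) ≡ lookup τ x) → (Ms : Tms Γ Ψ) → subs (rens ρ Ms) σ ≡ subs Ms τ
    subs-rens h []       = refl
    subs-rens h (M ∷ Ms) = cong₂ _∷_ (sub-ren h M) (subs-rens h Ms)

  rens-lift : (ρ : Ren Γ Δ) (σ : Tms Γ Θ) → rens (ext {A = A} ρ) (lift σ) ≡ lift (rens ρ σ)
  rens-lift ρ σ = cong (var here ∷_) (trans (rens-rens (λ _ → refl) σ) (sym (rens-rens (λ _ → refl) σ)))

  mutual
    ren-sub : (ρ : Ren Γ Δ) (σ : Tms Γ Θ) (M : Tm Θ A) → ren ρ (sub M σ) ≡ sub M (rens ρ σ)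
    ren-sub ρ σ (var x)    = sym (lookup-rens ρ σ x)
    ren-sub ρ σ tt         = refl
    ren-sub ρ σ (op c Ms)  = cong (op c) (rens-subs ρ σ Ms)
    ren-sub ρ σ (lam M)    = cong lam (trans (ren-sub (ext ρ) (lift σ) M) (cong (sub M) (rens-lift ρ σ)))
    ren-sub ρ σ (app M N)  = cong₂ app (ren-sub ρ σ M) (ren-sub ρ σ N)
    ren-sub ρ σ (pair M N) = cong₂ pair (ren-sub ρ σ M) (ren-sub ρ σ N)
    ren-sub ρ σ (fst M)    = cong fst (ren-sub ρ σ M)
    ren-sub ρ σ (snd M)    = cong snd (ren-sub ρ σ M)

    rens-subs : (ρ : Ren Γ Δ) (σ : Tms Γ Θ) (Ms : Tms Θ Ψ) → rens ρ (subs Ms σ) ≡ subs Ms (rens ρ σ)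
    rens-subs ρ σ []       = refl
    rens-subs ρ σ (M ∷ Ms) = cong₂ _∷_ (ren-sub ρ σ M) (rens-subs ρ σ Ms)

  subs-lift : (σ : Tms Δ Θ) (τ : Tms Γ Δ) → subs (lift {A = A} σ) (lift τ) ≡ lift (subs σ τ)
  subs-lift σ τ = cong (var here ∷_) (trans (subs-rens (λ _ → refl) σ) (sym (rens-subs there τ σ)))

  mutual
    sub-sub : (σ : Tms Δ Θ) (τ : Tms Γ Δ) (M : Tm Θ A) → sub (sub M σ) τ ≡ sub M (subs σ τ)
    sub-sub σ τ (var x)    = sym (lookup-subs σ τ x)
    sub-sub σ τ tt         = refl
    sub-sub σ τ (op c Ms)  = cong (op c) (subs-subs σ τ Ms)
    sub-sub σ τ (lam M)    = cong lam (trans (sub-sub (lift σ) (lift τ) M) (cong (sub M) (subs-lift σ τ)))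
    sub-sub σ τ (app M N)  = cong₂ app (sub-sub σ τ M) (sub-sub σ τ N)
    sub-sub σ τ (pair M N) = cong₂ pair (sub-sub σ τ M) (sub-sub σ τ N)
    sub-sub σ τ (fst M)    = cong fst (sub-sub σ τ M)
    sub-sub σ τ (snd M)    = cong snd (sub-sub σ τ M)

    subs-subs : (σ : Tms Δ Θ) (τ : Tms Γ Δ) (Ms : Tms Θ Ψ) → subs (subs Ms σ) τ ≡ subs Ms (subs σ τ)
    subs-subs σ τ []       = refl
    subs-subs σ τ (M ∷ Ms) = cong₂ _∷_ (sub-sub σ τ M) (subs-subs σ τ Ms)

  mutual
    sub-idS : (M : Tm Γ A) → sub M idS ≡ M
    sub-idS (var x)    = lookup-idS x
    sub-idS tt         = refl
    sub-idS (op c Ms)  = cong (op c) (subs-idS Ms)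
    sub-idS (lam M)    = cong lam (sub-idS M)
    sub-idS (app M N)  = cong₂ app (sub-idS M) (sub-idS N)
    sub-idS (pair M N) = cong₂ pair (sub-idS M) (sub-idS N)
    sub-idS (fst M)    = cong fst (sub-idS M)
    sub-idS (snd M)    = cong snd (sub-idS M)

    subs-idS : (Ms : Tms Γ Ψ) → subs Ms idS ≡ Ms
    subs-idS []       = refl
    subs-idS (M ∷ Ms) = cong₂ _∷_ (sub-idS M) (subs-idS Ms)

  idS-subs : (σ : Tms Γ Δ) → subs idS σ ≡ σ
  idS-subs []      = refl
  idS-subs (M ∷ σ) = cong (M ∷_) (trans (subs-rens (λ _ → refl) idS) (idS-subs σ))

  lift-subs-∷idS : (σ : Tms Γ Δ) (N : Tm Γ A) → subs (lift σ) (N ∷ idS) ≡ N ∷ σ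
  lift-subs-∷idS σ N = cong (N ∷_) (trans (subs-rens (λ _ → refl) σ) (subs-idS σ))

  ≈-reflexive : {M N : Tm Γ A} → M ≡ N → M ≈ N
  ≈-reflexive refl = ≈refl

  mutual
    ren-cong : (ρ : Ren Γ Δ) {M N : Tm Γ A} → M ≈ N → ren ρ M ≈ ren ρ N
    ren-cong ρ ≈refl        = ≈refl
    ren-cong ρ (≈sym p)     = ≈sym (ren-cong ρ p)
    ren-cong ρ (≈trans p q) = ≈trans (ren-cong ρ p) (ren-cong ρ q)
    ren-cong ρ (β {M = M} {N = N}) =
      ≈trans β (≈-reflexive (trans (sub-ren lookup-ext M) (sym (ren-sub ρ (N ∷ idS) M))))
      where
      lookup-ext : ∀ {A} (x : _ ∋ A) → lookup (ren ρ N ∷ idS) (ext ρ x) ≡ lookup (ren ρ N ∷ rens ρ idS) x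
      lookup-ext here      = refl
      lookup-ext (there x) = begin
        lookup idS (ρ x)          ≡⟨ lookup-idS (ρ x) ⟩
        var (ρ x)                 ≡⟨ cong (ren ρ) (lookup-idS x) ⟨
        ren ρ (lookup idS x)      ≡⟨ lookup-rens ρ idS x ⟨
        lookup (rens ρ idS) x     ∎
    ren-cong ρ (η {M = M}) =
      ≈trans η (≈-reflexive (cong (λ t → lam (app t (var here)))
                               (trans (ren-ren (λ _ → refl) M) (sym (ren-ren (λ _ → refl) M)))))
    ren-cong ρ β₁           = β₁
    ren-cong ρ β₂           = β₂
    ren-cong ρ η⊗           = η⊗
    ren-cong ρ η𝟙           = η𝟙
    ren-cong ρ (c-op p)     = c-op (rens-cong ρ p)
    ren-cong ρ (c-lam p)    = c-lam (ren-cong (ext ρ) p)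
    ren-cong ρ (c-app p q)  = c-app (ren-cong ρ p) (ren-cong ρ q)
    ren-cong ρ (c-pair p q) = c-pair (ren-cong ρ p) (ren-cong ρ q)
    ren-cong ρ (c-fst p)    = c-fst (ren-cong ρ p)
    ren-cong ρ (c-snd p)    = c-snd (ren-cong ρ p)

    rens-cong : (ρ : Ren Γ Δ) {Ms Ns : Tms Γ Ψ} → Ms ≈s Ns → rens ρ Ms ≈s rens ρ Ns
    rens-cong ρ []       = []
    rens-cong ρ (p ∷ ps) = ren-cong ρ p ∷ rens-cong ρ ps

  mutual
    sub-cong : (σ : Tms Γ Δ) {M N : Tm Δ A} → M ≈ N → sub M σ ≈ sub N σ
    sub-cong σ ≈refl        = ≈refl
    sub-cong σ (≈sym p)     = ≈sym (sub-cong σ p)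
    sub-cong σ (≈trans p q) = ≈trans (sub-cong σ p) (sub-cong σ q)
    sub-cong σ (β {M = M} {N = N}) = ≈trans β (≈-reflexive (begin
      sub (sub M (lift σ)) (sub N σ ∷ idS)  ≡⟨ sub-sub (lift σ) (sub N σ ∷ idS) M ⟩
      sub M (subs (lift σ) (sub N σ ∷ idS)) ≡⟨ cong (sub M) (lift-subs-∷idS σ (sub N σ)) ⟩
      sub M (sub N σ ∷ σ)                   ≡⟨ cong (λ τ → sub M (sub N σ ∷ τ)) (idS-subs σ) ⟨
      sub M (subs (N ∷ idS) σ)              ≡⟨ sub-sub (N ∷ idS) σ M ⟨
      sub (sub M (N ∷ idS)) σ               ∎))
    sub-cong σ (η {M = M}) =
      ≈trans η (≈-reflexive (cong (λ t → lam (app t (var here)))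
                               (trans (ren-sub there σ M) (sym (sub-ren (λ _ → refl) M)))))
    sub-cong σ β₁           = β₁
    sub-cong σ β₂           = β₂
    sub-cong σ η⊗           = η⊗
    sub-cong σ η𝟙           = η𝟙
    sub-cong σ (c-op p)     = c-op (subs-cong σ p)
    sub-cong σ (c-lam p)    = c-lam (sub-cong (lift σ) p)
    sub-cong σ (c-app p q)  = c-app (sub-cong σ p) (sub-cong σ q)
    sub-cong σ (c-pair p q) = c-pair (sub-cong σ p) (sub-cong σ q)
    sub-cong σ (c-fst p)    = c-fst (sub-cong σ p)
    sub-cong σ (c-snd p)    = c-snd (sub-cong σ p)

    subs-cong : (σ : Tms Γ Δ) {Ms Ns : Tms Δ Ψ} → Ms ≈s Ns → subs Ms σ ≈s subs Ns σ
    subs-cong σ []       = []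
    subs-cong σ (p ∷ ps) = sub-cong σ p ∷ subs-cong σ ps

module ReductionProperties (X : Sig2) where
  open Sig2 X
  open Red X
  open TermProperties sig1

  cong-⨾ : {P P' Q Q' : Rd Γ A} {M M' : Tm Γ A} →
           P ≡ P' → M ≡ M' → Q ≡ Q' → P ⨾⟨ M ⟩ Q ≡ P' ⨾⟨ M' ⟩ Q'
  cong-⨾ refl refl refl = refl

  wf-⨾ : {P Q : Rd Γ A} {M : Tm Γ A} → Wf P → Wf Q → tgt P ≡ M → M ≡ src Q → Wf (P ⨾⟨ M ⟩ Q)
  wf-⨾ w v p q = comp w v (≈-reflexive p) (≈-reflexive q)

  mutual
    src-⌜⌝ : (M : Tm Γ A) → src ⌜ M ⌝ ≡ M
    src-⌜⌝ (var x)    = refl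
    src-⌜⌝ tt         = refl
    src-⌜⌝ (op c Ms)  = cong (op c) (srcs-⌜⌝ Ms)
    src-⌜⌝ (lam M)    = cong lam (src-⌜⌝ M)
    src-⌜⌝ (app M N)  = cong₂ app (src-⌜⌝ M) (src-⌜⌝ N)
    src-⌜⌝ (pair M N) = cong₂ pair (src-⌜⌝ M) (src-⌜⌝ N)
    src-⌜⌝ (fst M)    = cong fst (src-⌜⌝ M)
    src-⌜⌝ (snd M)    = cong snd (src-⌜⌝ M)

    srcs-⌜⌝ : (Ms : Tms Γ Ψ) → srcs ⌜ Ms ⌝s ≡ Ms
    srcs-⌜⌝ []       = refl
    srcs-⌜⌝ (M ∷ Ms) = cong₂ _∷_ (src-⌜⌝ M) (srcs-⌜⌝ Ms)

  mutual
    tgt-⌜⌝ : (M : Tm Γ A) → tgt ⌜ M ⌝ ≡ M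
    tgt-⌜⌝ (var x)    = refl
    tgt-⌜⌝ tt         = refl
    tgt-⌜⌝ (op c Ms)  = cong (op c) (tgts-⌜⌝ Ms)
    tgt-⌜⌝ (lam M)    = cong lam (tgt-⌜⌝ M)
    tgt-⌜⌝ (app M N)  = cong₂ app (tgt-⌜⌝ M) (tgt-⌜⌝ N)
    tgt-⌜⌝ (pair M N) = cong₂ pair (tgt-⌜⌝ M) (tgt-⌜⌝ N)
    tgt-⌜⌝ (fst M)    = cong fst (tgt-⌜⌝ M)
    tgt-⌜⌝ (snd M)    = cong snd (tgt-⌜⌝ M)

    tgts-⌜⌝ : (Ms : Tms Γ Ψ) → tgts ⌜ Ms ⌝s ≡ Ms
    tgts-⌜⌝ []       = refl
    tgts-⌜⌝ (M ∷ Ms) = cong₂ _∷_ (tgt-⌜⌝ M) (tgts-⌜⌝ Ms)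

  mutual
    wf-⌜⌝ : (M : Tm Γ A) → Wf ⌜ M ⌝
    wf-⌜⌝ (var x)    = rvar
    wf-⌜⌝ tt         = rtt
    wf-⌜⌝ (op c Ms)  = rop (wfs-⌜⌝ Ms)
    wf-⌜⌝ (lam M)    = rlam (wf-⌜⌝ M)
    wf-⌜⌝ (app M N)  = rapp (wf-⌜⌝ M) (wf-⌜⌝ N)
    wf-⌜⌝ (pair M N) = rpair (wf-⌜⌝ M) (wf-⌜⌝ N)
    wf-⌜⌝ (fst M)    = rfst (wf-⌜⌝ M)
    wf-⌜⌝ (snd M)    = rsnd (wf-⌜⌝ M)

    wfs-⌜⌝ : (Ms : Tms Γ Ψ) → Wfs ⌜ Ms ⌝s
    wfs-⌜⌝ []       = []
    wfs-⌜⌝ (M ∷ Ms) = wf-⌜⌝ M ∷ wfs-⌜⌝ Ms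

  mutual
    rren-⌜⌝ : (ρ : Ren Γ Δ) (M : Tm Γ A) → rren ρ ⌜ M ⌝ ≡ ⌜ ren ρ M ⌝
    rren-⌜⌝ ρ (var x)    = refl
    rren-⌜⌝ ρ tt         = refl
    rren-⌜⌝ ρ (op c Ms)  = cong (rop c) (rrens-⌜⌝ ρ Ms)
    rren-⌜⌝ ρ (lam M)    = cong rlam (rren-⌜⌝ (ext ρ) M)
    rren-⌜⌝ ρ (app M N)  = cong₂ rapp (rren-⌜⌝ ρ M) (rren-⌜⌝ ρ N)
    rren-⌜⌝ ρ (pair M N) = cong₂ rpair (rren-⌜⌝ ρ M) (rren-⌜⌝ ρ N)
    rren-⌜⌝ ρ (fst M)    = cong rfst (rren-⌜⌝ ρ M)
    rren-⌜⌝ ρ (snd M)    = cong rsnd (rren-⌜⌝ ρ M)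

    rrens-⌜⌝ : (ρ : Ren Γ Δ) (Ms : Tms Γ Ψ) → rrens ρ ⌜ Ms ⌝s ≡ ⌜ rens ρ Ms ⌝s
    rrens-⌜⌝ ρ []       = refl
    rrens-⌜⌝ ρ (M ∷ Ms) = cong₂ _∷_ (rren-⌜⌝ ρ M) (rrens-⌜⌝ ρ Ms)

  mutual
    src-rren : (ρ : Ren Γ Δ) (P : Rd Γ A) → src (rren ρ P) ≡ ren ρ (src P)
    src-rren ρ (rvar x)     = refl
    src-rren ρ rtt          = refl
    src-rren ρ (rop c Ps)   = cong (op c) (srcs-rrens ρ Ps)
    src-rren ρ (rlam P)     = cong lam (src-rren (ext ρ) P)
    src-rren ρ (rapp P Q)   = cong₂ app (src-rren ρ P) (src-rren ρ Q)
    src-rren ρ (rpair P Q)  = cong₂ pair (src-rren ρ P) (src-rren ρ Q)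
    src-rren ρ (rfst P)     = cong fst (src-rren ρ P)
    src-rren ρ (rsnd P)     = cong snd (src-rren ρ P)
    src-rren ρ (rule r Ps)  = trans (cong (sub (rlhs r)) (srcs-rrens ρ Ps)) (sym (ren-sub ρ (srcs Ps) (rlhs r)))
    src-rren ρ (P ⨾⟨ M ⟩ Q) = src-rren ρ P

    srcs-rrens : (ρ : Ren Γ Δ) (Ps : Rds Γ Ψ) → srcs (rrens ρ Ps) ≡ rens ρ (srcs Ps)
    srcs-rrens ρ []       = refl
    srcs-rrens ρ (P ∷ Ps) = cong₂ _∷_ (src-rren ρ P) (srcs-rrens ρ Ps)

  mutual
    tgt-rren : (ρ : Ren Γ Δ) (P : Rd Γ A) → tgt (rren ρ P) ≡ ren ρ (tgt P)
    tgt-rren ρ (rvar x)     = refl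
    tgt-rren ρ rtt          = refl
    tgt-rren ρ (rop c Ps)   = cong (op c) (tgts-rrens ρ Ps)
    tgt-rren ρ (rlam P)     = cong lam (tgt-rren (ext ρ) P)
    tgt-rren ρ (rapp P Q)   = cong₂ app (tgt-rren ρ P) (tgt-rren ρ Q)
    tgt-rren ρ (rpair P Q)  = cong₂ pair (tgt-rren ρ P) (tgt-rren ρ Q)
    tgt-rren ρ (rfst P)     = cong fst (tgt-rren ρ P)
    tgt-rren ρ (rsnd P)     = cong snd (tgt-rren ρ P)
    tgt-rren ρ (rule r Ps)  = trans (cong (sub (rrhs r)) (tgts-rrens ρ Ps)) (sym (ren-sub ρ (tgts Ps) (rrhs r)))
    tgt-rren ρ (P ⨾⟨ M ⟩ Q) = tgt-rren ρ Q

    tgts-rrens : (ρ : Ren Γ Δ) (Ps : Rds Γ Ψ) → tgts (rrens ρ Ps) ≡ rens ρ (tgts Ps)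
    tgts-rrens ρ []       = refl
    tgts-rrens ρ (P ∷ Ps) = cong₂ _∷_ (tgt-rren ρ P) (tgts-rrens ρ Ps)

  mutual
    wf-rren : (ρ : Ren Γ Δ) {P : Rd Γ A} → Wf P → Wf (rren ρ P)
    wf-rren ρ rvar        = rvar
    wf-rren ρ rtt         = rtt
    wf-rren ρ (rop w)     = rop (wfs-rrens ρ w)
    wf-rren ρ (rlam w)    = rlam (wf-rren (ext ρ) w)
    wf-rren ρ (rapp w v)  = rapp (wf-rren ρ w) (wf-rren ρ v)
    wf-rren ρ (rpair w v) = rpair (wf-rren ρ w) (wf-rren ρ v)
    wf-rren ρ (rfst w)    = rfst (wf-rren ρ w)
    wf-rren ρ (rsnd w)    = rsnd (wf-rren ρ w)
    wf-rren ρ (rule w)    = rule (wfs-rrens ρ w)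
    wf-rren ρ (comp {P = P} {Q} w v p q) =
      comp (wf-rren ρ w) (wf-rren ρ v)
           (≈trans (≈-reflexive (tgt-rren ρ P)) (ren-cong ρ p))
           (≈trans (ren-cong ρ q) (≈-reflexive (sym (src-rren ρ Q))))

    wfs-rrens : (ρ : Ren Γ Δ) {Ps : Rds Γ Ψ} → Wfs Ps → Wfs (rrens ρ Ps)
    wfs-rrens ρ []       = []
    wfs-rrens ρ (w ∷ ws) = wf-rren ρ w ∷ wfs-rrens ρ ws

  mutual
    src-[]ʳ : (σ : Tms Γ Δ) (P : Rd Δ A) → src (P [ σ ]ʳ) ≡ sub (src P) σ
    src-[]ʳ σ (rvar x)     = src-⌜⌝ (lookup σ x)
    src-[]ʳ σ rtt          = refl
    src-[]ʳ σ (rop c Ps)   = cong (op c) (srcs-[]ʳs σ Ps)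
    src-[]ʳ σ (rlam P)     = cong lam (src-[]ʳ (lift σ) P)
    src-[]ʳ σ (rapp P Q)   = cong₂ app (src-[]ʳ σ P) (src-[]ʳ σ Q)
    src-[]ʳ σ (rpair P Q)  = cong₂ pair (src-[]ʳ σ P) (src-[]ʳ σ Q)
    src-[]ʳ σ (rfst P)     = cong fst (src-[]ʳ σ P)
    src-[]ʳ σ (rsnd P)     = cong snd (src-[]ʳ σ P)
    src-[]ʳ σ (rule r Ps)  = trans (cong (sub (rlhs r)) (srcs-[]ʳs σ Ps)) (sym (sub-sub (srcs Ps) σ (rlhs r)))
    src-[]ʳ σ (P ⨾⟨ M ⟩ Q) = src-[]ʳ σ P

    srcs-[]ʳs : (σ : Tms Γ Δ) (Ps : Rds Δ Ψ) → srcs (Ps [ σ ]ʳs) ≡ subs (srcs Ps) σ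
    srcs-[]ʳs σ []       = refl
    srcs-[]ʳs σ (P ∷ Ps) = cong₂ _∷_ (src-[]ʳ σ P) (srcs-[]ʳs σ Ps)

  mutual
    tgt-[]ʳ : (σ : Tms Γ Δ) (P : Rd Δ A) → tgt (P [ σ ]ʳ) ≡ sub (tgt P) σ
    tgt-[]ʳ σ (rvar x)     = tgt-⌜⌝ (lookup σ x)
    tgt-[]ʳ σ rtt          = refl
    tgt-[]ʳ σ (rop c Ps)   = cong (op c) (tgts-[]ʳs σ Ps)
    tgt-[]ʳ σ (rlam P)     = cong lam (tgt-[]ʳ (lift σ) P)
    tgt-[]ʳ σ (rapp P Q)   = cong₂ app (tgt-[]ʳ σ P) (tgt-[]ʳ σ Q)
    tgt-[]ʳ σ (rpair P Q)  = cong₂ pair (tgt-[]ʳ σ P) (tgt-[]ʳ σ Q)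
    tgt-[]ʳ σ (rfst P)     = cong fst (tgt-[]ʳ σ P)
    tgt-[]ʳ σ (rsnd P)     = cong snd (tgt-[]ʳ σ P)
    tgt-[]ʳ σ (rule r Ps)  = trans (cong (sub (rrhs r)) (tgts-[]ʳs σ Ps)) (sym (sub-sub (tgts Ps) σ (rrhs r)))
    tgt-[]ʳ σ (P ⨾⟨ M ⟩ Q) = tgt-[]ʳ σ Q

    tgts-[]ʳs : (σ : Tms Γ Δ) (Ps : Rds Δ Ψ) → tgts (Ps [ σ ]ʳs) ≡ subs (tgts Ps) σ
    tgts-[]ʳs σ []       = refl
    tgts-[]ʳs σ (P ∷ Ps) = cong₂ _∷_ (tgt-[]ʳ σ P) (tgts-[]ʳs σ Ps)

  mutual
    wf-[]ʳ : (σ : Tms Γ Δ) {P : Rd Δ A} → Wf P → Wf (P [ σ ]ʳ)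
    wf-[]ʳ σ (rvar {x = x}) = wf-⌜⌝ (lookup σ x)
    wf-[]ʳ σ rtt            = rtt
    wf-[]ʳ σ (rop w)        = rop (wfs-[]ʳs σ w)
    wf-[]ʳ σ (rlam w)       = rlam (wf-[]ʳ (lift σ) w)
    wf-[]ʳ σ (rapp w v)     = rapp (wf-[]ʳ σ w) (wf-[]ʳ σ v)
    wf-[]ʳ σ (rpair w v)    = rpair (wf-[]ʳ σ w) (wf-[]ʳ σ v)
    wf-[]ʳ σ (rfst w)       = rfst (wf-[]ʳ σ w)
    wf-[]ʳ σ (rsnd w)       = rsnd (wf-[]ʳ σ w)
    wf-[]ʳ σ (rule w)       = rule (wfs-[]ʳs σ w)
    wf-[]ʳ σ (comp {P = P} {Q} w v p q) =
      comp (wf-[]ʳ σ w) (wf-[]ʳ σ v)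
           (≈trans (≈-reflexive (tgt-[]ʳ σ P)) (sub-cong σ p))
           (≈trans (sub-cong σ q) (≈-reflexive (sym (src-[]ʳ σ Q))))

    wfs-[]ʳs : (σ : Tms Γ Δ) {Ps : Rds Δ Ψ} → Wfs Ps → Wfs (Ps [ σ ]ʳs)
    wfs-[]ʳs σ []       = []
    wfs-[]ʳs σ (w ∷ ws) = wf-[]ʳ σ w ∷ wfs-[]ʳs σ ws

  src-rlookup : (Q : Rds Γ Δ) (x : Δ ∋ A) → src (rlookup Q x) ≡ lookup (srcs Q) x
  src-rlookup (P ∷ Q) here      = refl
  src-rlookup (P ∷ Q) (there x) = src-rlookup Q x

  tgt-rlookup : (Q : Rds Γ Δ) (x : Δ ∋ A) → tgt (rlookup Q x) ≡ lookup (tgts Q) x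
  tgt-rlookup (P ∷ Q) here      = refl
  tgt-rlookup (P ∷ Q) (there x) = tgt-rlookup Q x

  wf-rlookup : {Q : Rds Γ Δ} → Wfs Q → (x : Δ ∋ A) → Wf (rlookup Q x)
  wf-rlookup (w ∷ ws) here      = w
  wf-rlookup (w ∷ ws) (there x) = wf-rlookup ws x

  rlookup-rrens : (ρ : Ren Γ Θ) (Q : Rds Γ Δ) (x : Δ ∋ A) → rlookup (rrens ρ Q) x ≡ rren ρ (rlookup Q x)
  rlookup-rrens ρ (P ∷ Q) here      = refl
  rlookup-rrens ρ (P ∷ Q) (there x) = rlookup-rrens ρ Q x

  rlookup-[]ʳs : (σ : Tms Γ Θ) (Q : Rds Θ Δ) (x : Δ ∋ A) → rlookup (Q [ σ ]ʳs) x ≡ rlookup Q x [ σ ]ʳ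
  rlookup-[]ʳs σ (P ∷ Q) here      = refl
  rlookup-[]ʳs σ (P ∷ Q) (there x) = rlookup-[]ʳs σ Q x

  rlookup-⌜⌝ : (σ : Tms Γ Δ) (x : Δ ∋ A) → rlookup ⌜ σ ⌝s x ≡ ⌜ lookup σ x ⌝
  rlookup-⌜⌝ (M ∷ σ) here      = refl
  rlookup-⌜⌝ (M ∷ σ) (there x) = rlookup-⌜⌝ σ x

  rlookup-⟦⟧s : (Ms : Tms Θ Δ) (Q : Rds Γ Θ) (x : Δ ∋ A) → rlookup (Ms ⟦ Q ⟧s) x ≡ lookup Ms x ⟦ Q ⟧
  rlookup-⟦⟧s (M ∷ Ms) Q here      = refl
  rlookup-⟦⟧s (M ∷ Ms) Q (there x) = rlookup-⟦⟧s Ms Q x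

  srcs-rlift : (Q : Rds Γ Δ) → srcs (rlift {A = A} Q) ≡ lift (srcs Q)
  srcs-rlift Q = cong (var here ∷_) (srcs-rrens there Q)

  tgts-rlift : (Q : Rds Γ Δ) → tgts (rlift {A = A} Q) ≡ lift (tgts Q)
  tgts-rlift Q = cong (var here ∷_) (tgts-rrens there Q)

  wfs-rlift : {Q : Rds Γ Δ} → Wfs Q → Wfs (rlift {A = A} Q)
  wfs-rlift ws = rvar ∷ wfs-rrens there ws

  mutual
    src-⟦⟧ : (M : Tm Δ A) (Q : Rds Γ Δ) → src (M ⟦ Q ⟧) ≡ sub M (srcs Q)
    src-⟦⟧ (var x)    Q = src-rlookup Q x
    src-⟦⟧ tt         Q = refl
    src-⟦⟧ (op c Ms)  Q = cong (op c) (srcs-⟦⟧s Ms Q)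
    src-⟦⟧ (lam M)    Q = cong lam (trans (src-⟦⟧ M (rlift Q)) (cong (sub M) (srcs-rlift Q)))
    src-⟦⟧ (app M N)  Q = cong₂ app (src-⟦⟧ M Q) (src-⟦⟧ N Q)
    src-⟦⟧ (pair M N) Q = cong₂ pair (src-⟦⟧ M Q) (src-⟦⟧ N Q)
    src-⟦⟧ (fst M)    Q = cong fst (src-⟦⟧ M Q)
    src-⟦⟧ (snd M)    Q = cong snd (src-⟦⟧ M Q)

    srcs-⟦⟧s : (Ms : Tms Δ Ψ) (Q : Rds Γ Δ) → srcs (Ms ⟦ Q ⟧s) ≡ subs Ms (srcs Q)
    srcs-⟦⟧s []       Q = refl
    srcs-⟦⟧s (M ∷ Ms) Q = cong₂ _∷_ (src-⟦⟧ M Q) (srcs-⟦⟧s Ms Q)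

  mutual
    tgt-⟦⟧ : (M : Tm Δ A) (Q : Rds Γ Δ) → tgt (M ⟦ Q ⟧) ≡ sub M (tgts Q)
    tgt-⟦⟧ (var x)    Q = tgt-rlookup Q x
    tgt-⟦⟧ tt         Q = refl
    tgt-⟦⟧ (op c Ms)  Q = cong (op c) (tgts-⟦⟧s Ms Q)
    tgt-⟦⟧ (lam M)    Q = cong lam (trans (tgt-⟦⟧ M (rlift Q)) (cong (sub M) (tgts-rlift Q)))
    tgt-⟦⟧ (app M N)  Q = cong₂ app (tgt-⟦⟧ M Q) (tgt-⟦⟧ N Q)
    tgt-⟦⟧ (pair M N) Q = cong₂ pair (tgt-⟦⟧ M Q) (tgt-⟦⟧ N Q)
    tgt-⟦⟧ (fst M)    Q = cong fst (tgt-⟦⟧ M Q)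
    tgt-⟦⟧ (snd M)    Q = cong snd (tgt-⟦⟧ M Q)

    tgts-⟦⟧s : (Ms : Tms Δ Ψ) (Q : Rds Γ Δ) → tgts (Ms ⟦ Q ⟧s) ≡ subs Ms (tgts Q)
    tgts-⟦⟧s []       Q = refl
    tgts-⟦⟧s (M ∷ Ms) Q = cong₂ _∷_ (tgt-⟦⟧ M Q) (tgts-⟦⟧s Ms Q)

  mutual
    wf-⟦⟧ : (M : Tm Δ A) {Q : Rds Γ Δ} → Wfs Q → Wf (M ⟦ Q ⟧)
    wf-⟦⟧ (var x)    ws = wf-rlookup ws x
    wf-⟦⟧ tt         ws = rtt
    wf-⟦⟧ (op c Ms)  ws = rop (wfs-⟦⟧s Ms ws)
    wf-⟦⟧ (lam M)    ws = rlam (wf-⟦⟧ M (wfs-rlift ws))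
    wf-⟦⟧ (app M N)  ws = rapp (wf-⟦⟧ M ws) (wf-⟦⟧ N ws)
    wf-⟦⟧ (pair M N) ws = rpair (wf-⟦⟧ M ws) (wf-⟦⟧ N ws)
    wf-⟦⟧ (fst M)    ws = rfst (wf-⟦⟧ M ws)
    wf-⟦⟧ (snd M)    ws = rsnd (wf-⟦⟧ M ws)

    wfs-⟦⟧s : (Ms : Tms Δ Ψ) {Q : Rds Γ Δ} → Wfs Q → Wfs (Ms ⟦ Q ⟧s)
    wfs-⟦⟧s []       ws = []
    wfs-⟦⟧s (M ∷ Ms) ws = wf-⟦⟧ M ws ∷ wfs-⟦⟧s Ms ws

  ≋-idˡ : {P : Rd Γ A} → Wf P → P ≋ ⌜ src P ⌝ ⨾⟨ src P ⟩ P
  ≋-idˡ {P = P} w = ≋sym (idˡ (wf-⨾ (wf-⌜⌝ (src P)) w (tgt-⌜⌝ (src P)) refl) w)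

  ≋-idʳ : {P : Rd Γ A} → Wf P → P ≋ P ⨾⟨ tgt P ⟩ ⌜ tgt P ⌝
  ≋-idʳ {P = P} w = ≋sym (idʳ (wf-⨾ w (wf-⌜⌝ (tgt P)) refl (sym (src-⌜⌝ (tgt P)))) w)

  ≋-assoc : {P Q R : Rd Γ A} {M K : Tm Γ A} → Wf P → Wf Q → Wf R →
            tgt P ≈ M → M ≈ src Q → tgt Q ≈ K → K ≈ src R →
            (P ⨾⟨ M ⟩ Q) ⨾⟨ K ⟩ R ≋ P ⨾⟨ M ⟩ (Q ⨾⟨ K ⟩ R)
  ≋-assoc wP wQ wR p q r s = assoc (comp (comp wP wQ p q) wR r s) (comp wP (comp wQ wR r s) p q)

  _[_]ʰ′ : Rd Δ A → Rds Γ Δ → Rd Γ A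
  P [ Q ]ʰ′ = src P ⟦ Q ⟧ ⨾⟨ sub (src P) (tgts Q) ⟩ P [ tgts Q ]ʳ

  _[_]ʰs : Rds Δ Ψ → Rds Γ Δ → Rds Γ Ψ
  Ps [ Q ]ʰs = compS (Ps [ srcs Q ]ʳs) (subs (tgts Ps) (srcs Q)) (tgts Ps ⟦ Q ⟧s)

  _[_]ʰ′s : Rds Δ Ψ → Rds Γ Δ → Rds Γ Ψ
  Ps [ Q ]ʰ′s = compS (srcs Ps ⟦ Q ⟧s) (subs (srcs Ps) (tgts Q)) (Ps [ tgts Q ]ʳs)

  wf-[]ʰ : {Q : Rds Γ Δ} → Wfs Q → {P : Rd Δ A} → Wf P → Wf (P [ Q ]ʰ)
  wf-[]ʰ {Q = Q} wq {P} w =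
    wf-⨾ (wf-[]ʳ (srcs Q) w) (wf-⟦⟧ (tgt P) wq) (tgt-[]ʳ (srcs Q) P) (sym (src-⟦⟧ (tgt P) Q))

  wf-[]ʰ′ : {Q : Rds Γ Δ} → Wfs Q → {P : Rd Δ A} → Wf P → Wf (P [ Q ]ʰ′)
  wf-[]ʰ′ {Q = Q} wq {P} w =
    wf-⨾ (wf-⟦⟧ (src P) wq) (wf-[]ʳ (tgts Q) w) (tgt-⟦⟧ (src P) Q) (sym (src-[]ʳ (tgts Q) P))

  wfs-[]ʰs : {Q : Rds Γ Δ} → Wfs Q → {Ps : Rds Δ Ψ} → Wfs Ps → Wfs (Ps [ Q ]ʰs)
  wfs-[]ʰs wq []       = []
  wfs-[]ʰs wq (w ∷ ws) = wf-[]ʰ wq w ∷ wfs-[]ʰs wq ws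

  wfs-[]ʰ′s : {Q : Rds Γ Δ} → Wfs Q → {Ps : Rds Δ Ψ} → Wfs Ps → Wfs (Ps [ Q ]ʰ′s)
  wfs-[]ʰ′s wq []       = []
  wfs-[]ʰ′s wq (w ∷ ws) = wf-[]ʰ′ wq w ∷ wfs-[]ʰ′s wq ws

  -- Whiskering commutes with renaming and substitution

  mutual
    rren-rren : {ρ₁ : Ren Δ Θ} {ρ₂ : Ren Γ Δ} {ρ₃ : Ren Γ Θ} →
      (∀ {A} (x : Γ ∋ A) → ρ₁ (ρ₂ x) ≡ ρ₃ x) → (P : Rd Γ A) → rren ρ₁ (rren ρ₂ P) ≡ rren ρ₃ P
    rren-rren h (rvar x)     = cong rvar (h x)
    rren-rren h rtt          = refl
    rren-rren h (rop c Ps)   = cong (rop c) (rrens-rrens h Ps)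
    rren-rren h (rlam P)     = cong rlam (rren-rren (ext-ext h) P)
    rren-rren h (rapp P Q)   = cong₂ rapp (rren-rren h P) (rren-rren h Q)
    rren-rren h (rpair P Q)  = cong₂ rpair (rren-rren h P) (rren-rren h Q)
    rren-rren h (rfst P)     = cong rfst (rren-rren h P)
    rren-rren h (rsnd P)     = cong rsnd (rren-rren h P)
    rren-rren h (rule r Ps)  = cong (rule r) (rrens-rrens h Ps)
    rren-rren h (P ⨾⟨ M ⟩ Q) = cong-⨾ (rren-rren h P) (ren-ren h M) (rren-rren h Q)

    rrens-rrens : {ρ₁ : Ren Δ Θ} {ρ₂ : Ren Γ Δ} {ρ₃ : Ren Γ Θ} →
      (∀ {A} (x : Γ ∋ A) → ρ₁ (ρ₂ x) ≡ ρ₃ x) → (Ps : Rds Γ Ψ) → rrens ρ₁ (rrens ρ₂ Ps) ≡ rrens ρ₃ Ps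
    rrens-rrens h []       = refl
    rrens-rrens h (P ∷ Ps) = cong₂ _∷_ (rren-rren h P) (rrens-rrens h Ps)

  mutual
    rren-id : {ρ : Ren Γ Γ} → (∀ {A} (x : Γ ∋ A) → ρ x ≡ x) → (P : Rd Γ A) → rren ρ P ≡ P
    rren-id h (rvar x)     = cong rvar (h x)
    rren-id h rtt          = refl
    rren-id h (rop c Ps)   = cong (rop c) (rrens-id h Ps)
    rren-id h (rlam P)     = cong rlam (rren-id (ext-id h) P)
    rren-id h (rapp P Q)   = cong₂ rapp (rren-id h P) (rren-id h Q)
    rren-id h (rpair P Q)  = cong₂ rpair (rren-id h P) (rren-id h Q)
    rren-id h (rfst P)     = cong rfst (rren-id h P)
    rren-id h (rsnd P)     = cong rsnd (rren-id h P)
    rren-id h (rule r Ps)  = cong (rule r) (rrens-id h Ps)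
    rren-id h (P ⨾⟨ M ⟩ Q) = cong-⨾ (rren-id h P) (ren-id h M) (rren-id h Q)

    rrens-id : {ρ : Ren Γ Γ} → (∀ {A} (x : Γ ∋ A) → ρ x ≡ x) → (Ps : Rds Γ Ψ) → rrens ρ Ps ≡ Ps
    rrens-id h []       = refl
    rrens-id h (P ∷ Ps) = cong₂ _∷_ (rren-id h P) (rrens-id h Ps)

  rlookup-rlift-ext : {ρ : Ren Δ Θ} {Q : Rds Γ Θ} {Q' : Rds Γ Δ} →
    (∀ {A} (x : Δ ∋ A) → rlookup Q (ρ x) ≡ rlookup Q' x) →
    ∀ {A B} (x : (B ∷ Δ) ∋ A) → rlookup (rlift Q) (ext ρ x) ≡ rlookup (rlift Q') x
  rlookup-rlift-ext h here = refl
  rlookup-rlift-ext {ρ = ρ} {Q} {Q'} h (there x) = begin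
    rlookup (rrens there Q) (ρ x)   ≡⟨ rlookup-rrens there Q (ρ x) ⟩
    rren there (rlookup Q (ρ x))    ≡⟨ cong (rren there) (h x) ⟩
    rren there (rlookup Q' x)       ≡⟨ rlookup-rrens there Q' x ⟨
    rlookup (rrens there Q') x      ∎

  mutual
    ⟦⟧-ren : {ρ : Ren Δ Θ} {Q : Rds Γ Θ} {Q' : Rds Γ Δ} →
      (∀ {A} (x : Δ ∋ A) → rlookup Q (ρ x) ≡ rlookup Q' x) → (M : Tm Δ A) → ren ρ M ⟦ Q ⟧ ≡ M ⟦ Q' ⟧
    ⟦⟧-ren h (var x)    = h x
    ⟦⟧-ren h tt         = refl
    ⟦⟧-ren h (op c Ms)  = cong (rop c) (⟦⟧s-rens h Ms)
    ⟦⟧-ren h (lam M)    = cong rlam (⟦⟧-ren (rlookup-rlift-ext h) M)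
    ⟦⟧-ren h (app M N)  = cong₂ rapp (⟦⟧-ren h M) (⟦⟧-ren h N)
    ⟦⟧-ren h (pair M N) = cong₂ rpair (⟦⟧-ren h M) (⟦⟧-ren h N)
    ⟦⟧-ren h (fst M)    = cong rfst (⟦⟧-ren h M)
    ⟦⟧-ren h (snd M)    = cong rsnd (⟦⟧-ren h M)

    ⟦⟧s-rens : {ρ : Ren Δ Θ} {Q : Rds Γ Θ} {Q' : Rds Γ Δ} →
      (∀ {A} (x : Δ ∋ A) → rlookup Q (ρ x) ≡ rlookup Q' x) → (Ms : Tms Δ Ψ) → rens ρ Ms ⟦ Q ⟧s ≡ Ms ⟦ Q' ⟧s
    ⟦⟧s-rens h []       = refl
    ⟦⟧s-rens h (M ∷ Ms) = cong₂ _∷_ (⟦⟧-ren h M) (⟦⟧s-rens h Ms)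

  rrens-rlift : (ρ : Ren Γ Θ) (Q : Rds Γ Δ) → rrens (ext {A = A} ρ) (rlift Q) ≡ rlift (rrens ρ Q)
  rrens-rlift ρ Q = cong (rvar here ∷_) (trans (rrens-rrens (λ _ → refl) Q) (sym (rrens-rrens (λ _ → refl) Q)))

  mutual
    rren-⟦⟧ : (ρ : Ren Γ Θ) (Q : Rds Γ Δ) (M : Tm Δ A) → rren ρ (M ⟦ Q ⟧) ≡ M ⟦ rrens ρ Q ⟧
    rren-⟦⟧ ρ Q (var x)    = sym (rlookup-rrens ρ Q x)
    rren-⟦⟧ ρ Q tt         = refl
    rren-⟦⟧ ρ Q (op c Ms)  = cong (rop c) (rrens-⟦⟧s ρ Q Ms)
    rren-⟦⟧ ρ Q (lam M)    = cong rlam (trans (rren-⟦⟧ (ext ρ) (rlift Q) M) (cong (M ⟦_⟧) (rrens-rlift ρ Q)))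
    rren-⟦⟧ ρ Q (app M N)  = cong₂ rapp (rren-⟦⟧ ρ Q M) (rren-⟦⟧ ρ Q N)
    rren-⟦⟧ ρ Q (pair M N) = cong₂ rpair (rren-⟦⟧ ρ Q M) (rren-⟦⟧ ρ Q N)
    rren-⟦⟧ ρ Q (fst M)    = cong rfst (rren-⟦⟧ ρ Q M)
    rren-⟦⟧ ρ Q (snd M)    = cong rsnd (rren-⟦⟧ ρ Q M)

    rrens-⟦⟧s : (ρ : Ren Γ Θ) (Q : Rds Γ Δ) (Ms : Tms Δ Ψ) → rrens ρ (Ms ⟦ Q ⟧s) ≡ Ms ⟦ rrens ρ Q ⟧s
    rrens-⟦⟧s ρ Q []       = refl
    rrens-⟦⟧s ρ Q (M ∷ Ms) = cong₂ _∷_ (rren-⟦⟧ ρ Q M) (rrens-⟦⟧s ρ Q Ms)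

  lift-⟦⟧s : (σ : Tms Δ Θ) (Q : Rds Γ Δ) → lift {A = A} σ ⟦ rlift Q ⟧s ≡ rlift (σ ⟦ Q ⟧s)
  lift-⟦⟧s σ Q = cong (rvar here ∷_) (trans (⟦⟧s-rens (λ _ → refl) σ) (sym (rrens-⟦⟧s there Q σ)))

  mutual
    ⟦⟧-sub : (σ : Tms Δ Θ) (Q : Rds Γ Δ) (M : Tm Θ A) → sub M σ ⟦ Q ⟧ ≡ M ⟦ σ ⟦ Q ⟧s ⟧
    ⟦⟧-sub σ Q (var x)    = sym (rlookup-⟦⟧s σ Q x)
    ⟦⟧-sub σ Q tt         = refl
    ⟦⟧-sub σ Q (op c Ms)  = cong (rop c) (⟦⟧s-subs σ Q Ms)
    ⟦⟧-sub σ Q (lam M)    = cong rlam (trans (⟦⟧-sub (lift σ) (rlift Q) M) (cong (M ⟦_⟧) (lift-⟦⟧s σ Q)))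
    ⟦⟧-sub σ Q (app M N)  = cong₂ rapp (⟦⟧-sub σ Q M) (⟦⟧-sub σ Q N)
    ⟦⟧-sub σ Q (pair M N) = cong₂ rpair (⟦⟧-sub σ Q M) (⟦⟧-sub σ Q N)
    ⟦⟧-sub σ Q (fst M)    = cong rfst (⟦⟧-sub σ Q M)
    ⟦⟧-sub σ Q (snd M)    = cong rsnd (⟦⟧-sub σ Q M)

    ⟦⟧s-subs : (σ : Tms Δ Θ) (Q : Rds Γ Δ) (Ms : Tms Θ Ψ) → subs Ms σ ⟦ Q ⟧s ≡ Ms ⟦ σ ⟦ Q ⟧s ⟧s
    ⟦⟧s-subs σ Q []       = refl
    ⟦⟧s-subs σ Q (M ∷ Ms) = cong₂ _∷_ (⟦⟧-sub σ Q M) (⟦⟧s-subs σ Q Ms)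

  idS-⟦⟧s : (Q : Rds Γ Δ) → idS ⟦ Q ⟧s ≡ Q
  idS-⟦⟧s []      = refl
  idS-⟦⟧s (P ∷ Q) = cong (P ∷_) (trans (⟦⟧s-rens (λ _ → refl) idS) (idS-⟦⟧s Q))

  rlift-⌜⌝ : (σ : Tms Γ Δ) → rlift {A = A} ⌜ σ ⌝s ≡ ⌜ lift σ ⌝s
  rlift-⌜⌝ σ = cong (rvar here ∷_) (rrens-⌜⌝ there σ)

  mutual
    ⟦⟧-⌜⌝ : (σ : Tms Γ Δ) (M : Tm Δ A) → M ⟦ ⌜ σ ⌝s ⟧ ≡ ⌜ sub M σ ⌝
    ⟦⟧-⌜⌝ σ (var x)    = rlookup-⌜⌝ σ x
    ⟦⟧-⌜⌝ σ tt         = refl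
    ⟦⟧-⌜⌝ σ (op c Ms)  = cong (rop c) (⟦⟧s-⌜⌝ σ Ms)
    ⟦⟧-⌜⌝ σ (lam M)    = cong rlam (trans (cong (M ⟦_⟧) (rlift-⌜⌝ σ)) (⟦⟧-⌜⌝ (lift σ) M))
    ⟦⟧-⌜⌝ σ (app M N)  = cong₂ rapp (⟦⟧-⌜⌝ σ M) (⟦⟧-⌜⌝ σ N)
    ⟦⟧-⌜⌝ σ (pair M N) = cong₂ rpair (⟦⟧-⌜⌝ σ M) (⟦⟧-⌜⌝ σ N)
    ⟦⟧-⌜⌝ σ (fst M)    = cong rfst (⟦⟧-⌜⌝ σ M)
    ⟦⟧-⌜⌝ σ (snd M)    = cong rsnd (⟦⟧-⌜⌝ σ M)

    ⟦⟧s-⌜⌝ : (σ : Tms Γ Δ) (Ms : Tms Δ Ψ) → Ms ⟦ ⌜ σ ⌝s ⟧s ≡ ⌜ subs Ms σ ⌝s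
    ⟦⟧s-⌜⌝ σ []       = refl
    ⟦⟧s-⌜⌝ σ (M ∷ Ms) = cong₂ _∷_ (⟦⟧-⌜⌝ σ M) (⟦⟧s-⌜⌝ σ Ms)

  mutual
    []ʳ-rren : {ρ : Ren Δ Θ} {τ : Tms Γ Θ} {τ' : Tms Γ Δ} →
      (∀ {A} (x : Δ ∋ A) → lookup τ (ρ x) ≡ lookup τ' x) → (P : Rd Δ A) → rren ρ P [ τ ]ʳ ≡ P [ τ' ]ʳ
    []ʳ-rren h (rvar x)     = cong ⌜_⌝ (h x)
    []ʳ-rren h rtt          = refl
    []ʳ-rren h (rop c Ps)   = cong (rop c) ([]ʳs-rrens h Ps)
    []ʳ-rren h (rlam P)     = cong rlam ([]ʳ-rren (lookup-lift-ext h) P)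
    []ʳ-rren h (rapp P Q)   = cong₂ rapp ([]ʳ-rren h P) ([]ʳ-rren h Q)
    []ʳ-rren h (rpair P Q)  = cong₂ rpair ([]ʳ-rren h P) ([]ʳ-rren h Q)
    []ʳ-rren h (rfst P)     = cong rfst ([]ʳ-rren h P)
    []ʳ-rren h (rsnd P)     = cong rsnd ([]ʳ-rren h P)
    []ʳ-rren h (rule r Ps)  = cong (rule r) ([]ʳs-rrens h Ps)
    []ʳ-rren h (P ⨾⟨ M ⟩ Q) = cong-⨾ ([]ʳ-rren h P) (sub-ren h M) ([]ʳ-rren h Q)

    []ʳs-rrens : {ρ : Ren Δ Θ} {τ : Tms Γ Θ} {τ' : Tms Γ Δ} →
      (∀ {A} (x : Δ ∋ A) → lookup τ (ρ x) ≡ lookup τ' x) → (Ps : Rds Δ Ψ) → rrens ρ Ps [ τ ]ʳs ≡ Ps [ τ' ]ʳs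
    []ʳs-rrens h []       = refl
    []ʳs-rrens h (P ∷ Ps) = cong₂ _∷_ ([]ʳ-rren h P) ([]ʳs-rrens h Ps)

  mutual
    rren-[]ʳ : (ρ : Ren Γ Θ) (σ : Tms Γ Δ) (P : Rd Δ A) → rren ρ (P [ σ ]ʳ) ≡ P [ rens ρ σ ]ʳ
    rren-[]ʳ ρ σ (rvar x)     = trans (rren-⌜⌝ ρ (lookup σ x)) (cong ⌜_⌝ (sym (lookup-rens ρ σ x)))
    rren-[]ʳ ρ σ rtt          = refl
    rren-[]ʳ ρ σ (rop c Ps)   = cong (rop c) (rrens-[]ʳs ρ σ Ps)
    rren-[]ʳ ρ σ (rlam P)     = cong rlam (trans (rren-[]ʳ (ext ρ) (lift σ) P) (cong (P [_]ʳ) (rens-lift ρ σ)))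
    rren-[]ʳ ρ σ (rapp P Q)   = cong₂ rapp (rren-[]ʳ ρ σ P) (rren-[]ʳ ρ σ Q)
    rren-[]ʳ ρ σ (rpair P Q)  = cong₂ rpair (rren-[]ʳ ρ σ P) (rren-[]ʳ ρ σ Q)
    rren-[]ʳ ρ σ (rfst P)     = cong rfst (rren-[]ʳ ρ σ P)
    rren-[]ʳ ρ σ (rsnd P)     = cong rsnd (rren-[]ʳ ρ σ P)
    rren-[]ʳ ρ σ (rule r Ps)  = cong (rule r) (rrens-[]ʳs ρ σ Ps)
    rren-[]ʳ ρ σ (P ⨾⟨ M ⟩ Q) = cong-⨾ (rren-[]ʳ ρ σ P) (ren-sub ρ σ M) (rren-[]ʳ ρ σ Q)

    rrens-[]ʳs : (ρ : Ren Γ Θ) (σ : Tms Γ Δ) (Ps : Rds Δ Ψ) → rrens ρ (Ps [ σ ]ʳs) ≡ Ps [ rens ρ σ ]ʳs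
    rrens-[]ʳs ρ σ []       = refl
    rrens-[]ʳs ρ σ (P ∷ Ps) = cong₂ _∷_ (rren-[]ʳ ρ σ P) (rrens-[]ʳs ρ σ Ps)

  mutual
    []ʳ-idS : (P : Rd Γ A) → P [ idS ]ʳ ≡ P
    []ʳ-idS (rvar x)     = cong ⌜_⌝ (lookup-idS x)
    []ʳ-idS rtt          = refl
    []ʳ-idS (rop c Ps)   = cong (rop c) ([]ʳs-idS Ps)
    []ʳ-idS (rlam P)     = cong rlam ([]ʳ-idS P)
    []ʳ-idS (rapp P Q)   = cong₂ rapp ([]ʳ-idS P) ([]ʳ-idS Q)
    []ʳ-idS (rpair P Q)  = cong₂ rpair ([]ʳ-idS P) ([]ʳ-idS Q)
    []ʳ-idS (rfst P)     = cong rfst ([]ʳ-idS P)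
    []ʳ-idS (rsnd P)     = cong rsnd ([]ʳ-idS P)
    []ʳ-idS (rule r Ps)  = cong (rule r) ([]ʳs-idS Ps)
    []ʳ-idS (P ⨾⟨ M ⟩ Q) = cong-⨾ ([]ʳ-idS P) (sub-idS M) ([]ʳ-idS Q)

    []ʳs-idS : (Ps : Rds Γ Ψ) → Ps [ idS ]ʳs ≡ Ps
    []ʳs-idS []       = refl
    []ʳs-idS (P ∷ Ps) = cong₂ _∷_ ([]ʳ-idS P) ([]ʳs-idS Ps)

  rlift-[]ʳs : (σ : Tms Γ Δ) (Q : Rds Δ Θ) → rlift {A = A} Q [ lift σ ]ʳs ≡ rlift (Q [ σ ]ʳs)
  rlift-[]ʳs σ Q = cong (rvar here ∷_) (trans ([]ʳs-rrens (λ _ → refl) Q) (sym (rrens-[]ʳs there σ Q)))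

  mutual
    ⟦⟧-[]ʳ : (σ : Tms Γ Θ) (Q : Rds Θ Δ) (M : Tm Δ A) → M ⟦ Q ⟧ [ σ ]ʳ ≡ M ⟦ Q [ σ ]ʳs ⟧
    ⟦⟧-[]ʳ σ Q (var x)    = sym (rlookup-[]ʳs σ Q x)
    ⟦⟧-[]ʳ σ Q tt         = refl
    ⟦⟧-[]ʳ σ Q (op c Ms)  = cong (rop c) (⟦⟧s-[]ʳs σ Q Ms)
    ⟦⟧-[]ʳ σ Q (lam M)    = cong rlam (trans (⟦⟧-[]ʳ (lift σ) (rlift Q) M) (cong (M ⟦_⟧) (rlift-[]ʳs σ Q)))
    ⟦⟧-[]ʳ σ Q (app M N)  = cong₂ rapp (⟦⟧-[]ʳ σ Q M) (⟦⟧-[]ʳ σ Q N)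
    ⟦⟧-[]ʳ σ Q (pair M N) = cong₂ rpair (⟦⟧-[]ʳ σ Q M) (⟦⟧-[]ʳ σ Q N)
    ⟦⟧-[]ʳ σ Q (fst M)    = cong rfst (⟦⟧-[]ʳ σ Q M)
    ⟦⟧-[]ʳ σ Q (snd M)    = cong rsnd (⟦⟧-[]ʳ σ Q M)

    ⟦⟧s-[]ʳs : (σ : Tms Γ Θ) (Q : Rds Θ Δ) (Ms : Tms Δ Ψ) → Ms ⟦ Q ⟧s [ σ ]ʳs ≡ Ms ⟦ Q [ σ ]ʳs ⟧s
    ⟦⟧s-[]ʳs σ Q []       = refl
    ⟦⟧s-[]ʳs σ Q (M ∷ Ms) = cong₂ _∷_ (⟦⟧-[]ʳ σ Q M) (⟦⟧s-[]ʳs σ Q Ms)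

  -- Functoriality of left whiskering

  record Composable (P : Rds Γ Δ) (K : Tms Γ Δ) (R : Rds Γ Δ) : Set where
    field
      wfsˡ   : Wfs P
      wfsʳ   : Wfs R
      tgts≡ˡ : tgts P ≡ K
      srcs≡ʳ : srcs R ≡ K

  wf-⟦⟧-⨾ : (M : Tm Δ A) {P R : Rds Γ Δ} {K : Tms Γ Δ} → Composable P K R →
            Wf (M ⟦ P ⟧ ⨾⟨ sub M K ⟩ M ⟦ R ⟧)
  wf-⟦⟧-⨾ M {P} {R} c = wf-⨾ (wf-⟦⟧ M wfsˡ) (wf-⟦⟧ M wfsʳ)
    (trans (tgt-⟦⟧ M P) (cong (sub M) tgts≡ˡ)) (sym (trans (src-⟦⟧ M R) (cong (sub M) srcs≡ʳ)))
    where open Composable c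

  wfs-⟦⟧s-⨾ : (Ms : Tms Δ Ψ) {P R : Rds Γ Δ} {K : Tms Γ Δ} → Composable P K R →
              Wfs (compS (Ms ⟦ P ⟧s) (subs Ms K) (Ms ⟦ R ⟧s))
  wfs-⟦⟧s-⨾ []       c = []
  wfs-⟦⟧s-⨾ (M ∷ Ms) c = wf-⟦⟧-⨾ M c ∷ wfs-⟦⟧s-⨾ Ms c

  Composable-rlift : {P R : Rds Γ Δ} {K : Tms Γ Δ} → Composable P K R →
                     Composable (rlift {A = A} P) (lift K) (rlift R)
  Composable-rlift {P = P} {R} c = record
    { wfsˡ   = wfs-rlift wfsˡ
    ; wfsʳ   = wfs-rlift wfsʳ
    ; tgts≡ˡ = trans (tgts-rlift P) (cong lift tgts≡ˡ)
    ; srcs≡ʳ = trans (srcs-rlift R) (cong lift srcs≡ʳ)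
    }
    where open Composable c

  record IsComposite (S P : Rds Γ Δ) (K : Tms Γ Δ) (R : Rds Γ Δ) : Set where
    field
      composable : Composable P K R
      -- Quantifying over renamings makes the hypothesis survive the weakening that happens under λ.
      rren-≋     : ∀ {Θ} (ρ : Ren Γ Θ) {B} (x : Δ ∋ B) →
                   rren ρ (rlookup S x) ≋ rren ρ (rlookup P x) ⨾⟨ ren ρ (lookup K x) ⟩ rren ρ (rlookup R x)

  IsComposite-rlookup : {S P R : Rds Γ Δ} {K : Tms Γ Δ} → IsComposite S P K R →
                        (x : Δ ∋ A) → rlookup S x ≋ rlookup P x ⨾⟨ lookup K x ⟩ rlookup R x
  IsComposite-rlookup {S = S} h x =
    subst₂ _≋_ (rren-id (λ _ → refl) (rlookup S x))
               (cong-⨾ (rren-id (λ _ → refl) _) (ren-id (λ _ → refl) _) (rren-id (λ _ → refl) _))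
               (IsComposite.rren-≋ h (λ z → z) x)

  IsComposite-rlift : {S P R : Rds Γ Δ} {K : Tms Γ Δ} → IsComposite S P K R →
                      IsComposite (rlift {A = A} S) (rlift P) (lift K) (rlift R)
  IsComposite-rlift {S = S} {P} {R} {K} h = record
    { composable = Composable-rlift (IsComposite.composable h)
    ; rren-≋     = lifted
    }
    where
    lifted : ∀ {Θ} (ρ : Ren _ Θ) {B} (x : _ ∋ B) →
             rren ρ (rlookup (rlift S) x) ≋
             rren ρ (rlookup (rlift P) x) ⨾⟨ ren ρ (lookup (lift K) x) ⟩ rren ρ (rlookup (rlift R) x)
    lifted ρ here      = ≋sym (idˡ (comp rvar rvar ≈refl ≈refl) rvar)
    lifted ρ (there y) =
      subst₂ _≋_ (weaken S) (cong-⨾ (weaken P) weakenK (weaken R)) (IsComposite.rren-≋ h (λ z → ρ (there z)) y)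
      where
      weaken : (T : Rds _ _) → rren (λ z → ρ (there z)) (rlookup T y) ≡ rren ρ (rlookup (rrens there T) y)
      weaken T = trans (sym (rren-rren (λ _ → refl) (rlookup T y))) (cong (rren ρ) (sym (rlookup-rrens there T y)))
      weakenK : ren (λ z → ρ (there z)) (lookup K y) ≡ ren ρ (lookup (rens there K) y)
      weakenK = trans (sym (ren-ren (λ _ → refl) (lookup K y))) (cong (ren ρ) (sym (lookup-rens there K y)))

  mutual
    ⟦⟧-⨾ : (M : Tm Δ A) {S P R : Rds Γ Δ} {K : Tms Γ Δ} → IsComposite S P K R →
           M ⟦ S ⟧ ≋ M ⟦ P ⟧ ⨾⟨ sub M K ⟩ M ⟦ R ⟧
    ⟦⟧-⨾ (var x)    h = IsComposite-rlookup h x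
    ⟦⟧-⨾ tt         h = ≋sym (idˡ (comp rtt rtt ≈refl ≈refl) rtt)
    ⟦⟧-⨾ (op c Ms)  h@record { composable = k } =
      ≋trans (c-op (⟦⟧s-⨾ Ms h)) (op-⨾ (rop (wfs-⟦⟧s-⨾ Ms k)) (wf-⟦⟧-⨾ (op c Ms) k))
    ⟦⟧-⨾ (lam M)    h@record { composable = k } =
      ≋trans (c-lam (⟦⟧-⨾ M (IsComposite-rlift h)))
             (lam-⨾ (rlam (wf-⟦⟧-⨾ M (Composable-rlift k))) (wf-⟦⟧-⨾ (lam M) k))
    ⟦⟧-⨾ (app M N)  h@record { composable = k } =
      ≋trans (c-app (⟦⟧-⨾ M h) (⟦⟧-⨾ N h))
             (app-⨾ (rapp (wf-⟦⟧-⨾ M k) (wf-⟦⟧-⨾ N k)) (wf-⟦⟧-⨾ (app M N) k))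
    ⟦⟧-⨾ (pair M N) h@record { composable = k } =
      ≋trans (c-pair (⟦⟧-⨾ M h) (⟦⟧-⨾ N h))
             (pair-⨾ (rpair (wf-⟦⟧-⨾ M k) (wf-⟦⟧-⨾ N k)) (wf-⟦⟧-⨾ (pair M N) k))
    ⟦⟧-⨾ (fst M)    h@record { composable = k } =
      ≋trans (c-fst (⟦⟧-⨾ M h)) (fst-⨾ (rfst (wf-⟦⟧-⨾ M k)) (wf-⟦⟧-⨾ (fst M) k))
    ⟦⟧-⨾ (snd M)    h@record { composable = k } =
      ≋trans (c-snd (⟦⟧-⨾ M h)) (snd-⨾ (rsnd (wf-⟦⟧-⨾ M k)) (wf-⟦⟧-⨾ (snd M) k))

    ⟦⟧s-⨾ : (Ms : Tms Δ Ψ) {S P R : Rds Γ Δ} {K : Tms Γ Δ} → IsComposite S P K R →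
            Ms ⟦ S ⟧s ≋s compS (Ms ⟦ P ⟧s) (subs Ms K) (Ms ⟦ R ⟧s)
    ⟦⟧s-⨾ []       h = []
    ⟦⟧s-⨾ (M ∷ Ms) h = ⟦⟧-⨾ M h ∷ ⟦⟧s-⨾ Ms h

  IsComposite-∷ : {P : Rd Γ A} {Q : Rds Γ Δ} → Wf P → Wfs Q →
                  IsComposite (P ∷ Q) (⌜ src P ⌝ ∷ Q) (src P ∷ tgts Q) (P ∷ ⌜ tgts Q ⌝s)
  IsComposite-∷ {P = P} {Q} wP wQ = record
    { composable = record
      { wfsˡ   = wf-⌜⌝ (src P) ∷ wQ
      ; wfsʳ   = wP ∷ wfs-⌜⌝ (tgts Q)
      ; tgts≡ˡ = cong (_∷ tgts Q) (tgt-⌜⌝ (src P))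
      ; srcs≡ʳ = cong (src P ∷_) (srcs-⌜⌝ (tgts Q))
      }
    ; rren-≋ = λ
      { ρ here → subst₂ _≋_ refl
          (cong-⨾ (trans (cong ⌜_⌝ (src-rren ρ P)) (sym (rren-⌜⌝ ρ (src P)))) (src-rren ρ P) refl)
          (≋-idˡ (wf-rren ρ wP))
      ; ρ (there y) → subst₂ _≋_ refl
          (cong-⨾ refl (tgt-rren-rlookup ρ y)
                  (trans (cong ⌜_⌝ (tgt-rren-rlookup ρ y)) (sym (rren-rlookup-⌜⌝ ρ y))))
          (≋-idʳ (wf-rren ρ (wf-rlookup wQ y)))
      }
    }
    where
    tgt-rren-rlookup : ∀ {Θ B} (ρ : Ren _ Θ) (y : _ ∋ B) → tgt (rren ρ (rlookup Q y)) ≡ ren ρ (lookup (tgts Q) y)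
    tgt-rren-rlookup ρ y = trans (tgt-rren ρ (rlookup Q y)) (cong (ren ρ) (tgt-rlookup Q y))
    rren-rlookup-⌜⌝ : ∀ {Θ B} (ρ : Ren _ Θ) (y : _ ∋ B) →
                      rren ρ (rlookup ⌜ tgts Q ⌝s y) ≡ ⌜ ren ρ (lookup (tgts Q) y) ⌝
    rren-rlookup-⌜⌝ ρ y = trans (cong (rren ρ) (rlookup-⌜⌝ (tgts Q) y)) (rren-⌜⌝ ρ (lookup (tgts Q) y))

  -- Left whiskering respects βη

  β-idS : {P : Rd (A ∷ Γ) B} {Q : Rd Γ A} → Wf P → Wf Q →
          rapp (rlam P) Q ≋ P [ src Q ∷ idS ]ʳ ⨾⟨ sub (tgt P) (src Q ∷ idS) ⟩ tgt P ⟦ Q ∷ ⌜ idS ⌝s ⟧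
  β-idS {P = P} {Q} wP wQ =
    subst₂ _≋_ refl
      (cong (λ σ → P [ src Q ∷ σ ]ʳ ⨾⟨ sub (tgt P) (src Q ∷ σ) ⟩ tgt P ⟦ Q ∷ ⌜ idS ⌝s ⟧) (srcs-⌜⌝ idS))
      (β (rapp (rlam wP) wQ) (wf-[]ʰ (wQ ∷ wfs-⌜⌝ idS) wP))

  rlift-[∷idS]ʳs : (Q : Rds Γ Δ) (a : Tm Γ A) → rlift Q [ a ∷ idS ]ʳs ≡ ⌜ a ⌝ ∷ Q
  rlift-[∷idS]ʳs Q a = cong (⌜ a ⌝ ∷_) (trans ([]ʳs-rrens (λ _ → refl) Q) ([]ʳs-idS Q))

  lift-⟦∷⌜idS⌝⟧s : (σ : Tms Γ Δ) (P : Rd Γ A) → lift σ ⟦ P ∷ ⌜ idS ⌝s ⟧s ≡ P ∷ ⌜ σ ⌝s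
  lift-⟦∷⌜idS⌝⟧s σ P = cong (P ∷_) (begin
    rens there σ ⟦ P ∷ ⌜ idS ⌝s ⟧s ≡⟨ ⟦⟧s-rens (λ _ → refl) σ ⟩
    σ ⟦ ⌜ idS ⌝s ⟧s                ≡⟨ ⟦⟧s-⌜⌝ idS σ ⟩
    ⌜ subs σ idS ⌝s                ≡⟨ cong ⌜_⌝s (subs-idS σ) ⟩
    ⌜ σ ⌝s                         ∎)

  -- β for whiskered terms: after contracting the redex, the argument N ⟦ Q ⟧ is split as
  -- id ; N ⟦ Q ⟧ and the remaining variables as Q ; id, and functoriality reassembles the two halves.
  ⟦⟧-β : (M : Tm (A ∷ Δ) B) (N : Tm Δ A) {Q : Rds Γ Δ} → Wfs Q →
         rapp (rlam (M ⟦ rlift Q ⟧)) (N ⟦ Q ⟧) ≋ sub M (N ∷ idS) ⟦ Q ⟧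
  ⟦⟧-β M N {Q} wq =
    subst₂ _≋_ refl reassemble
      (≋trans (subst₂ _≋_ refl (cong-⨾ split-src split-mid split-tgt) (β-idS (wf-⟦⟧ M (wfs-rlift wq)) wN))
              (≋sym (⟦⟧-⨾ M (IsComposite-∷ wN wq))))
    where
    N′ = N ⟦ Q ⟧
    wN = wf-⟦⟧ N wq
    a  = src N′
    tgt-M : tgt (M ⟦ rlift Q ⟧) ≡ sub M (lift (tgts Q))
    tgt-M = trans (tgt-⟦⟧ M (rlift Q)) (cong (sub M) (tgts-rlift Q))
    split-src : M ⟦ rlift Q ⟧ [ a ∷ idS ]ʳ ≡ M ⟦ ⌜ a ⌝ ∷ Q ⟧
    split-src = trans (⟦⟧-[]ʳ (a ∷ idS) (rlift Q) M) (cong (M ⟦_⟧) (rlift-[∷idS]ʳs Q a))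
    split-mid : sub (tgt (M ⟦ rlift Q ⟧)) (a ∷ idS) ≡ sub M (a ∷ tgts Q)
    split-mid = begin
      sub (tgt (M ⟦ rlift Q ⟧)) (a ∷ idS)   ≡⟨ cong (λ t → sub t (a ∷ idS)) tgt-M ⟩
      sub (sub M (lift (tgts Q))) (a ∷ idS) ≡⟨ sub-sub (lift (tgts Q)) (a ∷ idS) M ⟩
      sub M (subs (lift (tgts Q)) (a ∷ idS)) ≡⟨ cong (sub M) (lift-subs-∷idS (tgts Q) a) ⟩
      sub M (a ∷ tgts Q)                    ∎
    split-tgt : tgt (M ⟦ rlift Q ⟧) ⟦ N′ ∷ ⌜ idS ⌝s ⟧ ≡ M ⟦ N′ ∷ ⌜ tgts Q ⌝s ⟧
    split-tgt = begin
      tgt (M ⟦ rlift Q ⟧) ⟦ N′ ∷ ⌜ idS ⌝s ⟧        ≡⟨ cong (_⟦ N′ ∷ ⌜ idS ⌝s ⟧) tgt-M ⟩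
      sub M (lift (tgts Q)) ⟦ N′ ∷ ⌜ idS ⌝s ⟧      ≡⟨ ⟦⟧-sub (lift (tgts Q)) (N′ ∷ ⌜ idS ⌝s) M ⟩
      M ⟦ lift (tgts Q) ⟦ N′ ∷ ⌜ idS ⌝s ⟧s ⟧       ≡⟨ cong (M ⟦_⟧) (lift-⟦∷⌜idS⌝⟧s (tgts Q) N′) ⟩
      M ⟦ N′ ∷ ⌜ tgts Q ⌝s ⟧                       ∎
    reassemble : M ⟦ N′ ∷ Q ⟧ ≡ sub M (N ∷ idS) ⟦ Q ⟧
    reassemble = sym (trans (⟦⟧-sub (N ∷ idS) Q M) (cong (λ T → M ⟦ N′ ∷ T ⟧) (idS-⟦⟧s Q)))

  mutual
    ⟦⟧-cong : {M M' : Tm Δ A} → M ≈ M' → {Q : Rds Γ Δ} → Wfs Q → M ⟦ Q ⟧ ≋ M' ⟦ Q ⟧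
    ⟦⟧-cong {M = M} ≈refl wq = ≋refl (wf-⟦⟧ M wq)
    ⟦⟧-cong (≈sym p)     wq = ≋sym (⟦⟧-cong p wq)
    ⟦⟧-cong (≈trans p q) wq = ≋trans (⟦⟧-cong p wq) (⟦⟧-cong q wq)
    ⟦⟧-cong (β {M = M} {N = N}) wq = ⟦⟧-β M N wq
    ⟦⟧-cong (η {M = M}) {Q} wq =
      subst₂ _≋_ refl
        (cong (λ t → rlam (rapp t (rvar here))) (trans (rren-⟦⟧ there Q M) (sym (⟦⟧-ren (λ _ → refl) M))))
        (η (wf-⟦⟧ M wq) (rlam (rapp (wf-rren there (wf-⟦⟧ M wq)) rvar)))
    ⟦⟧-cong (β₁ {M = M} {N = N}) wq = β₁ (rfst (rpair (wf-⟦⟧ M wq) (wf-⟦⟧ N wq))) (wf-⟦⟧ M wq)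
    ⟦⟧-cong (β₂ {M = M} {N = N}) wq = β₂ (rsnd (rpair (wf-⟦⟧ M wq) (wf-⟦⟧ N wq))) (wf-⟦⟧ N wq)
    ⟦⟧-cong (η⊗ {M = M})        wq = η⊗ (wf-⟦⟧ M wq) (rpair (rfst (wf-⟦⟧ M wq)) (rsnd (wf-⟦⟧ M wq)))
    ⟦⟧-cong (η𝟙 {M = M})        wq = η𝟙 (wf-⟦⟧ M wq) rtt
    ⟦⟧-cong (c-op p)     wq = c-op (⟦⟧s-cong p wq)
    ⟦⟧-cong (c-lam p)    wq = c-lam (⟦⟧-cong p (wfs-rlift wq))
    ⟦⟧-cong (c-app p q)  wq = c-app (⟦⟧-cong p wq) (⟦⟧-cong q wq)
    ⟦⟧-cong (c-pair p q) wq = c-pair (⟦⟧-cong p wq) (⟦⟧-cong q wq)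
    ⟦⟧-cong (c-fst p)    wq = c-fst (⟦⟧-cong p wq)
    ⟦⟧-cong (c-snd p)    wq = c-snd (⟦⟧-cong p wq)

    ⟦⟧s-cong : {Ms Ns : Tms Δ Ψ} → Ms ≈s Ns → {Q : Rds Γ Δ} → Wfs Q → Ms ⟦ Q ⟧s ≋s Ns ⟦ Q ⟧s
    ⟦⟧s-cong []       wq = []
    ⟦⟧s-cong (p ∷ ps) wq = ⟦⟧-cong p wq ∷ ⟦⟧s-cong ps wq

  -- The interchange law

  interchange-lam : {Q : Rds Γ Δ} → Wfs Q → {P : Rd (A ∷ Δ) B} → Wf P →
                    P [ rlift Q ]ʰ ≋ P [ rlift Q ]ʰ′ → rlam P [ Q ]ʰ ≋ rlam P [ Q ]ʰ′
  interchange-lam {Q = Q} wq {P} w ih =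
    ≋trans (≋sym (lam-⨾ (rlam (subst Wf lift-srcs (wf-[]ʰ wq′ w))) (wf-[]ʰ wq (rlam w))))
      (≋trans (c-lam (subst₂ _≋_ lift-srcs lift-tgts ih))
              (lam-⨾ (rlam (subst Wf lift-tgts (wf-[]ʰ′ wq′ w))) (wf-[]ʰ′ wq (rlam w))))
    where
    wq′ = wfs-rlift wq
    lift-srcs : P [ rlift Q ]ʰ ≡ P [ lift (srcs Q) ]ʳ ⨾⟨ sub (tgt P) (lift (srcs Q)) ⟩ tgt P ⟦ rlift Q ⟧
    lift-srcs = cong (λ σ → P [ σ ]ʳ ⨾⟨ sub (tgt P) σ ⟩ tgt P ⟦ rlift Q ⟧) (srcs-rlift Q)
    lift-tgts : P [ rlift Q ]ʰ′ ≡ src P ⟦ rlift Q ⟧ ⨾⟨ sub (src P) (lift (tgts Q)) ⟩ P [ lift (tgts Q) ]ʳ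
    lift-tgts = cong (λ σ → src P ⟦ rlift Q ⟧ ⨾⟨ sub (src P) σ ⟩ P [ σ ]ʳ) (tgts-rlift Q)

  interchange-rule : {Q : Rds Γ Δ} → Wfs Q → {r : Rule} {Ps : Rds Δ (rctx r)} → Wfs Ps →
                     Ps [ Q ]ʰs ≋s Ps [ Q ]ʰ′s → rule r Ps [ Q ]ʰ ≋ rule r Ps [ Q ]ʰ′
  interchange-rule {Q = Q} wq {r} {Ps} ws ih =
    subst₂ _≋_ (sym rhs-whiskered) (sym lhs-whiskered)
      (≋trans (≋sym (rule-r (rule (wfs-[]ʰs wq ws)) (subst Wf rhs-whiskered (wf-[]ʰ wq (rule ws)))))
        (≋trans (c-rule ih) (rule-l (rule (wfs-[]ʰ′s wq ws)) (subst Wf lhs-whiskered (wf-[]ʰ′ wq (rule ws))))))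
    where
    rhs-whiskered : rule r Ps [ Q ]ʰ ≡
                    rule r (Ps [ srcs Q ]ʳs) ⨾⟨ sub (rrhs r) (subs (tgts Ps) (srcs Q)) ⟩ rrhs r ⟦ tgts Ps ⟦ Q ⟧s ⟧
    rhs-whiskered = cong-⨾ refl (sub-sub (tgts Ps) (srcs Q) (rrhs r)) (⟦⟧-sub (tgts Ps) Q (rrhs r))
    lhs-whiskered : rule r Ps [ Q ]ʰ′ ≡
                    rlhs r ⟦ srcs Ps ⟦ Q ⟧s ⟧ ⨾⟨ sub (rlhs r) (subs (srcs Ps) (tgts Q)) ⟩ rule r (Ps [ tgts Q ]ʳs)
    lhs-whiskered = cong-⨾ (⟦⟧-sub (srcs Ps) Q (rlhs r)) (sub-sub (srcs Ps) (tgts Q) (rlhs r)) refl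

  -- Push P₂[N] past (tgt P₂)[Q], trade (src P₂)[Q] for the βη-equal (tgt P₁)[Q], then push P₁[N] past it.
  interchange-⨾ : {Q : Rds Γ Δ} → Wfs Q → {P₁ P₂ : Rd Δ A} {K : Tm Δ A} →
                  Wf P₁ → Wf P₂ → tgt P₁ ≈ K → K ≈ src P₂ →
                  P₁ [ Q ]ʰ ≋ P₁ [ Q ]ʰ′ → P₂ [ Q ]ʰ ≋ P₂ [ Q ]ʰ′ →
                  (P₁ ⨾⟨ K ⟩ P₂) [ Q ]ʰ ≋ (P₁ ⨾⟨ K ⟩ P₂) [ Q ]ʰ′
  interchange-⨾ {Q = Q} wq {P₁} {P₂} {K} w₁ w₂ p q ih₁ ih₂ =
    ≋trans (≋-assoc wP₁N wP₂N (wf-⟦⟧ (tgt P₂) wq) P₁N-K K-P₂N (≈-reflexive (tgt-[]ʳ N P₂))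
                    (≈-reflexive (sym (src-⟦⟧ (tgt P₂) Q))))
    (≋trans (c-comp (≋refl wP₁N) ≈refl ih₂)
    (≋trans (≋sym (≋-assoc wP₁N (wf-⟦⟧ (src P₂) wq) wP₂N′ P₁N-K K-srcP₂Q
                           (≈-reflexive (tgt-⟦⟧ (src P₂) Q)) (≈-reflexive (sym (src-[]ʳ N′ P₂)))))
    (≋trans (c-comp (c-comp (≋refl wP₁N) (sub-cong N (≈sym p)) (⟦⟧-cong (≈sym (≈trans p q)) wq))
                    ≈refl (≋refl wP₂N′))
    (≋trans (c-comp ih₁ ≈refl (≋refl wP₂N′))
    (≋trans (≋-assoc (wf-⟦⟧ (src P₁) wq) wP₁N′ wP₂N′ (≈-reflexive (tgt-⟦⟧ (src P₁) Q))
                     (≈-reflexive (sym (src-[]ʳ N′ P₁))) P₁N′-srcP₂N′ (≈-reflexive (sym (src-[]ʳ N′ P₂))))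
            (c-comp (≋refl (wf-⟦⟧ (src P₁) wq)) ≈refl
                    (c-comp (≋refl wP₁N′) (sub-cong N′ (≈sym q)) (≋refl wP₂N′))))))))
    where
    N  = srcs Q
    N′ = tgts Q
    wP₁N  = wf-[]ʳ N w₁
    wP₂N  = wf-[]ʳ N w₂
    wP₁N′ = wf-[]ʳ N′ w₁
    wP₂N′ = wf-[]ʳ N′ w₂
    P₁N-K : tgt (P₁ [ N ]ʳ) ≈ sub K N
    P₁N-K = ≈trans (≈-reflexive (tgt-[]ʳ N P₁)) (sub-cong N p)
    K-P₂N : sub K N ≈ src (P₂ [ N ]ʳ)
    K-P₂N = ≈trans (sub-cong N q) (≈-reflexive (sym (src-[]ʳ N P₂)))
    K-srcP₂Q : sub K N ≈ src (src P₂ ⟦ Q ⟧)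
    K-srcP₂Q = ≈trans (sub-cong N q) (≈-reflexive (sym (src-⟦⟧ (src P₂) Q)))
    P₁N′-srcP₂N′ : tgt (P₁ [ N′ ]ʳ) ≈ sub (src P₂) N′
    P₁N′-srcP₂N′ = ≈trans (≈-reflexive (tgt-[]ʳ N′ P₁)) (sub-cong N′ (≈trans p q))

  mutual
    interchange : {Q : Rds Γ Δ} → Wfs Q → {P : Rd Δ A} → Wf P → P [ Q ]ʰ ≋ P [ Q ]ʰ′
    interchange wq (rvar {x = x}) =
      ≋trans (idˡ (wf-[]ʰ wq rvar) (wf-rlookup wq x)) (≋sym (idʳ (wf-[]ʰ′ wq rvar) (wf-rlookup wq x)))
    interchange wq rtt = ≋refl (wf-[]ʰ wq rtt)
    interchange wq (rop ws) =
      ≋trans (≋sym (op-⨾ (rop (wfs-[]ʰs wq ws)) (wf-[]ʰ wq (rop ws))))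
        (≋trans (c-op (interchanges wq ws)) (op-⨾ (rop (wfs-[]ʰ′s wq ws)) (wf-[]ʰ′ wq (rop ws))))
    interchange wq (rlam w) = interchange-lam wq w (interchange (wfs-rlift wq) w)
    interchange wq (rapp w v) =
      ≋trans (≋sym (app-⨾ (rapp (wf-[]ʰ wq w) (wf-[]ʰ wq v)) (wf-[]ʰ wq (rapp w v))))
        (≋trans (c-app (interchange wq w) (interchange wq v))
                (app-⨾ (rapp (wf-[]ʰ′ wq w) (wf-[]ʰ′ wq v)) (wf-[]ʰ′ wq (rapp w v))))
    interchange wq (rpair w v) =
      ≋trans (≋sym (pair-⨾ (rpair (wf-[]ʰ wq w) (wf-[]ʰ wq v)) (wf-[]ʰ wq (rpair w v))))
        (≋trans (c-pair (interchange wq w) (interchange wq v))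
                (pair-⨾ (rpair (wf-[]ʰ′ wq w) (wf-[]ʰ′ wq v)) (wf-[]ʰ′ wq (rpair w v))))
    interchange wq (rfst w) =
      ≋trans (≋sym (fst-⨾ (rfst (wf-[]ʰ wq w)) (wf-[]ʰ wq (rfst w))))
        (≋trans (c-fst (interchange wq w)) (fst-⨾ (rfst (wf-[]ʰ′ wq w)) (wf-[]ʰ′ wq (rfst w))))
    interchange wq (rsnd w) =
      ≋trans (≋sym (snd-⨾ (rsnd (wf-[]ʰ wq w)) (wf-[]ʰ wq (rsnd w))))
        (≋trans (c-snd (interchange wq w)) (snd-⨾ (rsnd (wf-[]ʰ′ wq w)) (wf-[]ʰ′ wq (rsnd w))))
    interchange wq (rule ws) = interchange-rule wq ws (interchanges wq ws)
    interchange wq (comp w₁ w₂ p q) = interchange-⨾ wq w₁ w₂ p q (interchange wq w₁) (interchange wq w₂)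

    interchanges : {Q : Rds Γ Δ} → Wfs Q → {Ps : Rds Δ Ψ} → Wfs Ps → Ps [ Q ]ʰs ≋s Ps [ Q ]ʰ′s
    interchanges wq []       = []
    interchanges wq (w ∷ ws) = interchange wq w ∷ interchanges wq ws

proposition5p8 : (X : Sig2) → let open Red X in
    ∀ {Γ Δ A} (Q : Rds Γ Δ) (P : Rd Δ A) → Wfs Q → Wf P →
    (P [ Q ]ʰ) ≋ vcomp (src P ⟦ Q ⟧) (sub (src P) (tgts Q)) (P [ tgts Q ]ʳ)
proposition5p8 X Q P wq wp = ReductionProperties.interchange X wq wp
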